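{- Let $n\geq1$, $\boldsymbol{\varepsilon}=(\varepsilon_1,\ldots,\varepsilon_n)\in\{\pm1\}^n$, let $C=C(\boldsymbol{\varepsilon})$ be the graphical scheme of dimension $n$ with $C_{i,j}=\prod_{k=i}^j\varepsilon_k$, and let $C_-$ be the scheme generated by $(-1,\ldots,-1)$, i.e. $(C_-)_{i,j}=(-1)^{j-i+1}$. Then there is a finite list of moves of types $\mathrm{P}$, $\mathrm{H}$, $\mathrm{V}$ and $\mathrm{S}$ which, applied successively, transforms $C$ into $C_-$.
   Context: A graphical scheme of dimension $n$ is an assignment of a sign $C_{i,j}\in\{+,-\}$ to each pair $1\leq i\leq j\leq n$. The moves, each changing only the indicated entries and applicable only when the indicated entries have the indicated signs, are: $\mathrm{P}(i;j)$: changes $C_{i,j}=+$ to $-$. $\mathrm{H}(i;j,j')$ with $j<j'$: changes $C_{i,j}=+$, $C_{i,j'}=-$ into $C_{i,j}=-$, $C_{i,j'}=+$. $\mathrm{V}(i,i';j)$ with $i<i'\leq j$: changes $C_{i,j}=-$, $C_{i',j}=+$ into $C_{i,j}=+$, $C_{i',j}=-$. $\mathrm{S}(i,i';j,j')$ with $i<i'\leq j<j'$: changes $C_{i,j}=-$, $C_{i,j'}=+$, $C_{i',j}=+$, $C_{i',j'}=-$ into $C_{i,j}=+$, $C_{i,j'}=-$, $C_{i',j}=-$, $C_{i',j'}=+$. -}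

module Defs where

open import Data.Nat using (ℕ; zero; suc; _+_; _∸_; _≤_; _<_)
open import Data.Bool using (Bool; true; false; not; _xor_)
open import Data.Product using (_×_; _,_)
open import Data.Sum using (_⊎_)
open import Data.List using (List; []; _∷_)
open import Data.List.Membership.Propositional using (_∉_)
open import Relation.Binary.PropositionalEquality using (_≡_)

-- Signs: true = +, false = -.
Sign : Set
Sign = Bool

-- A graphical scheme of dimension n: C i j is the sign C_{i,j}
-- (indices 1-based); only entries with 1 ≤ i ≤ j ≤ n are meaningful.
Scheme : Set
Scheme = ℕ → ℕ → Sign

Valid : ℕ → ℕ → ℕ → Set
Valid n i j = (1 ≤ i) × (i ≤ j) × (j ≤ n)

SameScheme : ℕ → Scheme → Scheme → Set
SameScheme n C D = ∀ i j → Valid n i j → C i j ≡ D i j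

AgreeOutside : ℕ → List (ℕ × ℕ) → Scheme → Scheme → Set
AgreeOutside n ps C D = ∀ i j → Valid n i j → (i , j) ∉ ps → C i j ≡ D i j

data Move (n : ℕ) (C D : Scheme) : Set where
  P : ∀ i j → Valid n i j →
      C i j ≡ true → D i j ≡ false →
      AgreeOutside n ((i , j) ∷ []) C D → Move n C D
  H : ∀ i j j' → Valid n i j → Valid n i j' → j < j' →
      C i j ≡ true → C i j' ≡ false →
      D i j ≡ false → D i j' ≡ true →
      AgreeOutside n ((i , j) ∷ (i , j') ∷ []) C D → Move n C D
  V : ∀ i i' j → Valid n i j → Valid n i' j → i < i' →
      C i j ≡ false → C i' j ≡ true →
      D i j ≡ true → D i' j ≡ false →
      AgreeOutside n ((i , j) ∷ (i' , j) ∷ []) C D → Move n C D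
  S : ∀ i i' j j' → Valid n i j → Valid n i j' → Valid n i' j → Valid n i' j' →
      i < i' → j < j' →
      C i j ≡ false → C i j' ≡ true → C i' j ≡ true → C i' j' ≡ false →
      D i j ≡ true → D i j' ≡ false → D i' j ≡ false → D i' j' ≡ true →
      AgreeOutside n ((i , j) ∷ (i , j') ∷ (i' , j) ∷ (i' , j') ∷ []) C D →
      Move n C D

data Moves (n : ℕ) : Scheme → Scheme → Set where
  done : ∀ {C D} → SameScheme n C D → Moves n C D
  step : ∀ {C D E} → Move n C D → Moves n D E → Moves n C E

_·_ : Sign → Sign → Sign
a · b = not (a xor b)

-- ∏_{k=i}^{j} ε_k, for ε given as a function on ℕ (index 1..n).
-- prodFrom ε i m = ε_i · ε_{i+1} · ... · ε_{i+m-1}  (empty product = +).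
prodFrom : (ℕ → Sign) → ℕ → ℕ → Sign
prodFrom ε i zero    = true
prodFrom ε i (suc m) = ε i · prodFrom ε (suc i) m

schemeOf : (ℕ → Sign) → Scheme
schemeOf ε i j = prodFrom ε i (suc (j ∸ i))

parity : ℕ → Sign
parity zero    = true
parity (suc m) = not (parity m)

C₋ : Scheme
C₋ i j = parity (suc (j ∸ i))

module Submission where

-- Write C(ε)_{i,j} = s_{i-1} s_j with s_a = ε_1 ⋯ ε_a, and (C₋)_{i,j} = t_{i-1} t_j with t_a = (-1)^a.
-- Call an index a ∈ {0, …, n} of class A when s_a ≠ t_a and of class B otherwise: C(ε) and C₋
-- then differ exactly at the cells (a + 1, b), a < b, whose indices have different classes. The
-- cells with an A-index before a B-index are corrected first, then the others (swap the classes).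
--
-- Each correction is an induction on a set of alive indices, consecutive alive indices having
-- alternating parity. A first alive index of class B lies in no cell to correct and is dropped.
-- Otherwise, the height of the A-indices is the walk that steps by ±(-1)^y at each alive A-index y,
-- the global sign chosen so that its last minimum on {0, …, n + 1} is at some x ≤ n; then x is
-- an alive A-index at which the walk rises. If x has no alive predecessor, its row is
-- swept with P and H moves; if its predecessor u is an A-index, rows u and x are swept with V and
-- S moves; otherwise the two alive indices before x are B-indices (an A followed by a B before x
-- would undercut the minimum) and their columns are swept with H and S moves. In every sweep the
-- minimality of the height is the ballot condition that matches each cell that must become +
-- with an earlier cell that must become −. The swept indices are removed and the induction goes on.

open import Defs
open import Data.Nat using (ℕ; zero; suc; z≤n; s≤s)
import Data.Nat.Properties as ℕ
open import Data.Bool using (Bool; true; false; not; _∧_; _∨_; _xor_; if_then_else_)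
open import Data.Bool.Properties
  using (xor-identityʳ; xor-assoc; ∧-zeroʳ; ∨-zeroʳ; not-involutive; not-distribˡ-xor;
         ∧-conicalˡ; ∧-conicalʳ; T-≡)
open import Data.Bool.Solver using (module xor-∧-Solver)
open import Data.Product using (_×_; _,_; proj₁; proj₂; ∃-syntax)
open import Data.Sum using (_⊎_; inj₁; inj₂)
open import Data.Empty using (⊥; ⊥-elim)
open import Data.List using (List; []; _∷_; _++_; length; filterᵇ; downFrom)
open import Data.List.Relation.Unary.Any using (here; there)
open import Data.List.Relation.Unary.All as All using (All; []; _∷_; lookup)
open import Data.List.Relation.Unary.AllPairs as AllPairs using (AllPairs; []; _∷_)
open import Data.List.Relation.Unary.AllPairs.Properties using (filter⁺; applyDownFrom⁺₁)
open import Data.List.Membership.Propositional using (_∈_; _∉_)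
open import Data.List.Membership.Propositional.Properties using (∈-filter⁺; ∈-filter⁻; ∈-downFrom⁺; ∈-downFrom⁻)
open import Data.List.Relation.Binary.Permutation.Propositional as ↭ using (_↭_)
open import Data.List.Relation.Binary.Permutation.Propositional.Properties using (++-comm)
open import Function using (_∘_; id; flip; case_of_)
open import Function.Bundles using (Equivalence)
open import Induction.WellFounded using (Acc; acc)
open import Data.Nat.Induction using (<-wellFounded)
open import Relation.Nullary using (proof; ¬_; yes; no)
open import Relation.Nullary.Reflects using (ofʸ; ofⁿ)
open import Relation.Nullary.Decidable using (T?; dec-true; dec-false)
open import Relation.Binary using (tri<; tri≈; tri>)
open import Relation.Binary.PropositionalEquality

open xor-∧-Solver using (solve; _:+_; _:*_; _:=_; con)

Region : Set
Region = ℕ → ℕ → Bool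

∅ : Region
∅ _ _ = false

-- Opaque, so that R can be recovered from X ⊕ R by unification.
opaque
  _⊕_ : Scheme → Region → Scheme
  (X ⊕ R) i j = R i j xor X i j

  _⊻_ : Region → Region → Region
  (Q ⊻ R) i j = Q i j xor R i j

infixl 6 _⊕_
infixr 7 _⊻_

opaque
  unfolding _⊕_ _⊻_

  ⊕-at : ∀ X R i j → (X ⊕ R) i j ≡ R i j xor X i j
  ⊕-at X R i j = refl

  ⊻-at : ∀ Q R i j → (Q ⊻ R) i j ≡ Q i j xor R i j
  ⊻-at Q R i j = refl

  ⊕-∅ : ∀ X i j → (X ⊕ ∅) i j ≡ X i j
  ⊕-∅ X i j = refl

  ⊕-⊕ : ∀ X Q R i j → (X ⊕ Q ⊕ R) i j ≡ (X ⊕ (Q ⊻ R)) i j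
  ⊕-⊕ X Q R i j = solve 3 (λ q r x → r :+ (q :+ x) := (q :+ r) :+ x) refl (Q i j) (R i j) (X i j)

  ⊻-identityˡ : ∀ R i j → (∅ ⊻ R) i j ≡ R i j
  ⊻-identityˡ R i j = refl

  ⊻-identityʳ : ∀ R i j → (R ⊻ ∅) i j ≡ R i j
  ⊻-identityʳ R i j = xor-identityʳ (R i j)

  ⊻-middle : ∀ A B C i j → ((A ⊻ B) ⊻ C) i j ≡ (B ⊻ (A ⊻ C)) i j
  ⊻-middle A B C i j = solve 3 (λ a b c → (a :+ b) :+ c := b :+ (a :+ c)) refl (A i j) (B i j) (C i j)

  ⊻-interchange : ∀ A B C D i j → ((A ⊻ B) ⊻ (C ⊻ D)) i j ≡ ((A ⊻ C) ⊻ (B ⊻ D)) i j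
  ⊻-interchange A B C D i j =
    solve 4 (λ a b c d → (a :+ b) :+ (c :+ d) := (a :+ c) :+ (b :+ d)) refl (A i j) (B i j) (C i j) (D i j)

xor-true : ∀ b → b xor true ≡ not b
xor-true true  = refl
xor-true false = refl

not-xor-true : ∀ b → not b xor true ≡ b
not-xor-true b = trans (xor-true (not b)) (not-involutive b)

module _ where

  open import Data.Nat using (_≤_; _<_; _>_; _+_; _≟_; _≡ᵇ_)

  cell : ℕ × ℕ → Region
  cell (a , b) i j = (i ≡ᵇ a) ∧ (j ≡ᵇ b)

  cells : List (ℕ × ℕ) → Region
  cells []       i j = false
  cells (c ∷ cs) i j = cell c i j xor cells cs i j

  cells-++ : ∀ cs ds i j → cells (cs ++ ds) i j ≡ (cells cs ⊻ cells ds) i j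
  cells-++ []       ds i j = sym (⊻-identityˡ (cells ds) i j)
  cells-++ (c ∷ cs) ds i j rewrite cells-++ cs ds i j | ⊻-at (cells (c ∷ cs)) (cells ds) i j =
    trans (cong (cell c i j xor_) (⊻-at (cells cs) (cells ds) i j)) (sym (xor-assoc (cell c i j) (cells cs i j) (cells ds i j)))

  cells-↭ : ∀ {cs ds} → cs ↭ ds → ∀ i j → cells cs i j ≡ cells ds i j
  cells-↭ ↭.refl         i j = refl
  cells-↭ (↭.prep c p)   i j = cong (cell c i j xor_) (cells-↭ p i j)
  cells-↭ {c ∷ d ∷ cs} {_ ∷ _ ∷ ds} (↭.swap _ _ p) i j =
    trans (cong (λ r → cell c i j xor (cell d i j xor r)) (cells-↭ p i j))
          (solve 3 (λ x y r → x :+ (y :+ r) := y :+ (x :+ r)) refl (cell c i j) (cell d i j) (cells ds i j))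
  cells-↭ (↭.trans p q)  i j = trans (cells-↭ p i j) (cells-↭ q i j)

  cells-outside : ∀ cs {i j} → (i , j) ∉ cs → cells cs i j ≡ false
  cells-outside []             _  = refl
  cells-outside ((a , b) ∷ cs) {i} {j} ∉cs with i ≡ᵇ a | proof (i ≟ a) | j ≡ᵇ b | proof (j ≟ b)
  ... | true  | ofʸ refl | true  | ofʸ refl = ⊥-elim (∉cs (here refl))
  ... | true  | _        | false | _        = cells-outside cs (∉cs ∘ there)
  ... | false | _        | _     | _        = cells-outside cs (∉cs ∘ there)

  cells-true : ∀ cs {i j} → cells cs i j ≡ true → (i , j) ∈ cs
  cells-true ((a , b) ∷ cs) {i} {j} e with i ≡ᵇ a | proof (i ≟ a) | j ≡ᵇ b | proof (j ≟ b)
  ... | true  | ofʸ refl | true  | ofʸ refl = here refl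
  ... | true  | _        | false | _        = there (cells-true cs e)
  ... | false | _        | _     | _        = there (cells-true cs e)

  cells-inside : ∀ {cs i j} → AllPairs _≢_ cs → (i , j) ∈ cs → cells cs i j ≡ true
  cells-inside {(a , b) ∷ cs} (a∉ ∷ _) (here refl)
    rewrite dec-true (a ≟ a) refl | dec-true (b ≟ b) refl | cells-outside cs (λ m → lookup a∉ m refl) = refl
  cells-inside {(a , b) ∷ cs} {i} {j} (a∉ ∷ distinct) (there m) with i ≡ᵇ a | proof (i ≟ a) | j ≡ᵇ b | proof (j ≟ b)
  ... | true  | ofʸ refl | true  | ofʸ refl = ⊥-elim (lookup a∉ m refl)
  ... | true  | _        | false | _        = cells-inside distinct m
  ... | false | _        | _     | _        = cells-inside distinct m

  rows-differ : ∀ {i i′ j j′ : ℕ} → i < i′ → (i , j) ≢ (i′ , j′)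
  rows-differ lt refl = ℕ.<-irrefl refl lt

  columns-differ : ∀ {i i′ j j′ : ℕ} → j < j′ → (i , j) ≢ (i′ , j′)
  columns-differ lt refl = ℕ.<-irrefl refl lt

  module _ {n : ℕ} where

    Move-respˡ : ∀ {X X′ Y} → SameScheme n X X′ → Move n X′ Y → Move n X Y
    Move-respˡ e (P i j v x y out) = P i j v (trans (e i j v) x) y (λ a b w ∉ → trans (e a b w) (out a b w ∉))
    Move-respˡ e (H i j j′ v v′ lt x x′ y y′ out) =
      H i j j′ v v′ lt (trans (e i j v) x) (trans (e i j′ v′) x′) y y′ (λ a b w ∉ → trans (e a b w) (out a b w ∉))
    Move-respˡ e (V i i′ j v v′ lt x x′ y y′ out) =
      V i i′ j v v′ lt (trans (e i j v) x) (trans (e i′ j v′) x′) y y′ (λ a b w ∉ → trans (e a b w) (out a b w ∉))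
    Move-respˡ e (S i i′ j j′ v₁ v₂ v₃ v₄ lt lt′ x₁ x₂ x₃ x₄ y₁ y₂ y₃ y₄ out) =
      S i i′ j j′ v₁ v₂ v₃ v₄ lt lt′ (trans (e i j v₁) x₁) (trans (e i j′ v₂) x₂) (trans (e i′ j v₃) x₃)
        (trans (e i′ j′ v₄) x₄) y₁ y₂ y₃ y₄ (λ a b w ∉ → trans (e a b w) (out a b w ∉))

    Moves-respˡ : ∀ {X X′ Y} → SameScheme n X X′ → Moves n X′ Y → Moves n X Y
    Moves-respˡ e (done e′)   = done (λ i j v → trans (e i j v) (e′ i j v))
    Moves-respˡ e (step m ms) = step (Move-respˡ e m) ms

    Moves-respʳ : ∀ {X Y Y′} → Moves n X Y → SameScheme n Y Y′ → Moves n X Y′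
    Moves-respʳ (done e)    e′ = done (λ i j v → trans (e i j v) (e′ i j v))
    Moves-respʳ (step m ms) e′ = step m (Moves-respʳ ms e′)

    _◅◅_ : ∀ {X Y Z} → Moves n X Y → Moves n Y Z → Moves n X Z
    done e   ◅◅ ms = Moves-respˡ e ms
    step m r ◅◅ ms = step m (r ◅◅ ms)

    single-move : ∀ {X Y} → Move n X Y → Moves n X Y
    single-move m = step m (done (λ _ _ _ → refl))

    ⊕-cong : ∀ {X R R′} → (∀ i j → Valid n i j → R i j ≡ R′ i j) → Moves n X (X ⊕ R) → Moves n X (X ⊕ R′)
    ⊕-cong {X} {R} {R′} e ms =
      Moves-respʳ ms (λ i j v → trans (⊕-at X R i j) (trans (cong (_xor X i j) (e i j v)) (sym (⊕-at X R′ i j))))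

    _▷_ : ∀ {X R R′} → Moves n X (X ⊕ R) → Moves n (X ⊕ R) (X ⊕ R ⊕ R′) → Moves n X (X ⊕ (R ⊻ R′))
    _▷_ {X} {R} {R′} ms ms′ = ms ◅◅ Moves-respʳ ms′ (λ i j _ → ⊕-⊕ X R R′ i j)

    infixr 5 _▷_

    flips-listed : ∀ {X cs i j b} → AllPairs _≢_ cs → (i , j) ∈ cs → X i j ≡ b → (X ⊕ cells cs) i j ≡ not b
    flips-listed {X} {cs} {i} {j} distinct m refl rewrite ⊕-at X (cells cs) i j | cells-inside distinct m = refl

    keeps-unlisted : ∀ {X} cs → AgreeOutside n cs X (X ⊕ cells cs)
    keeps-unlisted {X} cs i j _ ∉cs rewrite ⊕-at X (cells cs) i j | cells-outside cs ∉cs = refl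

    moveP : ∀ {X i j} → Valid n i j → X i j ≡ true → Move n X (X ⊕ cells ((i , j) ∷ []))
    moveP {X} {i} {j} v x = P i j v x (flips-listed {X} ([] ∷ []) (here refl) x) (keeps-unlisted _)

    moveH : ∀ {X i j j′} → Valid n i j → Valid n i j′ → j < j′ → X i j ≡ true → X i j′ ≡ false →
            Move n X (X ⊕ cells ((i , j) ∷ (i , j′) ∷ []))
    moveH {X} {i} {j} {j′} v v′ lt x x′ =
      H i j j′ v v′ lt x x′ (flips-listed {X} distinct (here refl) x) (flips-listed {X} distinct (there (here refl)) x′)
        (keeps-unlisted _)
      where distinct = (columns-differ lt ∷ []) ∷ [] ∷ []

    moveV : ∀ {X i i′ j} → Valid n i j → Valid n i′ j → i < i′ → X i j ≡ false → X i′ j ≡ true →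
            Move n X (X ⊕ cells ((i , j) ∷ (i′ , j) ∷ []))
    moveV {X} {i} {i′} {j} v v′ lt x x′ =
      V i i′ j v v′ lt x x′ (flips-listed {X} distinct (here refl) x) (flips-listed {X} distinct (there (here refl)) x′)
        (keeps-unlisted _)
      where distinct = (rows-differ lt ∷ []) ∷ [] ∷ []

    moveS : ∀ {X i i′ j j′} → Valid n i j → Valid n i j′ → Valid n i′ j → Valid n i′ j′ →
            i < i′ → j < j′ →
            X i j ≡ false → X i j′ ≡ true → X i′ j ≡ true → X i′ j′ ≡ false →
            Move n X (X ⊕ cells ((i , j) ∷ (i , j′) ∷ (i′ , j) ∷ (i′ , j′) ∷ []))
    moveS {X} {i} {i′} {j} {j′} v₁ v₂ v₃ v₄ lt lt′ x₁ x₂ x₃ x₄ =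
      S i i′ j j′ v₁ v₂ v₃ v₄ lt lt′ x₁ x₂ x₃ x₄
        (flips-listed {X} distinct (here refl) x₁) (flips-listed {X} distinct (there (here refl)) x₂)
        (flips-listed {X} distinct (there (there (here refl))) x₃)
        (flips-listed {X} distinct (there (there (there (here refl)))) x₄)
        (keeps-unlisted _)
      where
      distinct = (columns-differ lt′ ∷ rows-differ lt ∷ rows-differ lt ∷ []) ∷ (rows-differ lt ∷ rows-differ lt ∷ [])
               ∷ (columns-differ lt′ ∷ []) ∷ [] ∷ []

  -- Scanning ps from the left, starting with k unmatched positions labelled true, every position
  -- labelled false can be matched with an earlier, still unmatched, position labelled true.
  data Ballot (g : ℕ → Bool) : ℕ → List ℕ → Set where
    []   : ∀ {k} → Ballot g k []
    push : ∀ {k p ps} → g p ≡ true  → Ballot g (suc k) ps → Ballot g k (p ∷ ps)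
    pop  : ∀ {k p ps} → g p ≡ false → Ballot g k ps → Ballot g (suc k) (p ∷ ps)

  module Tiling (n : ℕ) (tile : ℕ → List (ℕ × ℕ)) (pat : Region)
                (tile-distinct : ∀ p → AllPairs _≢_ (tile p))
                (tile-injective : ∀ {p q c} → c ∈ tile p → c ∈ tile q → p ≡ q) where

    tiles : List ℕ → Region
    tiles []       = ∅
    tiles (p ∷ ps) = cells (tile p) ⊻ tiles ps

    -- The tile of p shows pat when b is true and its negation when b is false.
    Shows : Scheme → ℕ → Bool → Set
    Shows X p b = ∀ i j → (i , j) ∈ tile p → Valid n i j × X i j ≡ not b xor pat i j

    Shows-⊕ : ∀ {X R q b} → (∀ {i j} → (i , j) ∈ tile q → R i j ≡ false) → Shows X q b → Shows (X ⊕ R) q b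
    Shows-⊕ {X} {R} off s i j c∈ rewrite ⊕-at X R i j | off c∈ = s i j c∈

    other-tile-off : ∀ {q x i j} → q ≢ x → (i , j) ∈ tile q → cells (tile x) i j ≡ false
    other-tile-off q≢x c∈ = cells-outside _ (λ c∈x → q≢x (tile-injective c∈ c∈x))

    tiles-miss : ∀ ps {i j} → (∀ {p} → p ∈ ps → (i , j) ∉ tile p) → tiles ps i j ≡ false
    tiles-miss []       _   = refl
    tiles-miss (p ∷ ps) {i} {j} off =
      trans (⊻-at _ _ i j) (cong₂ _xor_ (cells-outside (tile p) (off (here refl))) (tiles-miss ps (off ∘ there)))

    tiles-true : ∀ ps {i j} → tiles ps i j ≡ true → ∃[ p ] p ∈ ps × (i , j) ∈ tile p
    tiles-true (p ∷ ps) {i} {j} e with cells (tile p) i j in c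
    ... | true  = p , here refl , cells-true (tile p) c
    ... | false with q , q∈ , c∈ ← tiles-true ps (trans (cong (_xor tiles ps i j) (sym c))
                                                        (trans (sym (⊻-at (cells (tile p)) (tiles ps) i j)) e))
      = q , there q∈ , c∈

    tiles-hit : ∀ {ps p i j} → AllPairs _≢_ ps → p ∈ ps → (i , j) ∈ tile p → tiles ps i j ≡ true
    tiles-hit {p ∷ ps} {i = i} {j} (p∉ ∷ _) (here refl) c∈ =
      trans (⊻-at _ _ i j) (cong₂ _xor_ (cells-inside (tile-distinct p) c∈)
                                        (tiles-miss ps (λ q∈ c∈q → lookup p∉ q∈ (tile-injective c∈ c∈q))))
    tiles-hit {q ∷ ps} {i = i} {j} (q∉ ∷ distinct) (there p∈) c∈ =
      trans (⊻-at _ _ i j) (cong₂ _xor_ (other-tile-off (λ p≡q → lookup q∉ p∈ (sym p≡q)) c∈)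
                                        (tiles-hit distinct p∈ c∈))

    module Sweep (_≺_ : ℕ → ℕ → Set) (≺⇒≢ : ∀ {p q} → p ≺ q → p ≢ q)
      (pair   : ∀ {X x y} → x ≺ y → Shows X x true → Shows X y false →
                Moves n X (X ⊕ (cells (tile x) ⊻ cells (tile y))))
      (single : ∀ {X x} → Shows X x true → Moves n X (X ⊕ cells (tile x))) where

      -- Q holds the unmatched positions labelled true, latest first, all read before ps.
      Pending : List ℕ → List ℕ → Set
      Pending Q ps = AllPairs (flip _≺_) Q × All (λ q → All (q ≺_) ps) Q × AllPairs _≺_ ps

      off-both : ∀ {q x y i j} → q ≢ x → q ≢ y → (i , j) ∈ tile q →
                 (cells (tile x) ⊻ cells (tile y)) i j ≡ false
      off-both {i = i} {j} q≢x q≢y c∈ =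
        trans (⊻-at _ _ i j) (cong₂ _xor_ (other-tile-off q≢x c∈) (other-tile-off q≢y c∈))

      flush : ∀ {X} Q → AllPairs (flip _≺_) Q → All (λ q → Shows X q true) Q → Moves n X (X ⊕ tiles Q)
      flush {X} []  _                _         = done (λ i j _ → sym (⊕-∅ X i j))
      flush {X} (x ∷ Q) (below ∷ sorted) (sx ∷ sQ) =
        single sx ▷ flush Q sorted (All.zipWith untouched (below , sQ))
        where
        untouched : ∀ {q} → q ≺ x × Shows X q true → Shows (X ⊕ cells (tile x)) q true
        untouched (q≺x , sq) = Shows-⊕ {b = true} (other-tile-off (≺⇒≢ q≺x)) sq

      sweep : ∀ {g k ps} → Ballot g k ps → ∀ {X} Q → length Q ≡ k → Pending Q ps →
              All (λ q → Shows X q true) Q → All (λ p → Shows X p (g p)) ps →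
              Moves n X (X ⊕ (tiles Q ⊻ tiles ps))
      sweep [] Q _ (sorted , _ , _) sQ _ =
        ⊕-cong (λ i j _ → sym (⊻-identityʳ (tiles Q) i j)) (flush Q sorted sQ)
      sweep (push {p = p} {ps′} gp b) {X} Q refl (sorted , before , p≺ ∷ sorted′) sQ (sp ∷ sps) =
        ⊕-cong (λ i j _ → ⊻-middle (cells (tile p)) (tiles Q) (tiles ps′) i j)
          (sweep b (p ∷ Q) refl (All.map All.head before ∷ sorted , p≺ ∷ All.map All.tail before , sorted′)
                 (subst (Shows X p) gp sp ∷ sQ) sps)
      sweep {g} (pop {p = p} {ps′} gp b) {X} (x ∷ Q) len (below ∷ sorted , x≺ ∷ before , p≺ ∷ sorted′)
            (sx ∷ sQ) (sp ∷ sps) =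
        ⊕-cong (λ i j _ → ⊻-interchange (cells (tile x)) (cells (tile p)) (tiles Q) (tiles ps′) i j)
          (pair (All.head x≺) sx (subst (Shows X p) gp sp) ▷
           sweep b Q (ℕ.suc-injective len) (sorted , All.map All.tail before , sorted′)
                 (All.zipWith pending-untouched (below , All.zip (before , sQ)))
                 (All.zipWith unread-untouched (All.zip (All.tail x≺ , p≺) , sps)))
        where
        X′ = X ⊕ (cells (tile x) ⊻ cells (tile p))
        pending-untouched : ∀ {q} → q ≺ x × All (q ≺_) (p ∷ ps′) × Shows X q true → Shows X′ q true
        pending-untouched (q≺x , q≺ , sq) = Shows-⊕ {b = true} (off-both (≺⇒≢ q≺x) (≺⇒≢ (All.head q≺))) sq
        unread-untouched : ∀ {r} → (x ≺ r × p ≺ r) × Shows X r (g r) → Shows X′ r (g r)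
        unread-untouched {r} ((x≺r , p≺r) , sr) =
          Shows-⊕ {b = g r} (off-both (≢-sym (≺⇒≢ x≺r)) (≢-sym (≺⇒≢ p≺r))) sr

      sweep-all : ∀ {g ps X} → Ballot g 0 ps → AllPairs _≺_ ps → All (λ p → Shows X p (g p)) ps →
                  Moves n X (X ⊕ tiles ps)
      sweep-all {ps = ps} b sorted sps =
        ⊕-cong (λ i j _ → ⊻-identityˡ (tiles ps) i j) (sweep b [] refl ([] , [] , sorted) [] sps)

  module RowSweep (n r : ℕ) where

    tile : ℕ → List (ℕ × ℕ)
    tile p = (r , p) ∷ []

    plus : Region
    plus _ _ = true

    tile-injective : ∀ {p q c} → c ∈ tile p → c ∈ tile q → p ≡ q
    tile-injective (here refl) (here refl) = refl

    tile-distinct : ∀ p → AllPairs _≢_ (tile p)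
    tile-distinct _ = [] ∷ []

    open Tiling n tile plus tile-distinct tile-injective public

    Local : Scheme → ℕ → Bool → Set
    Local X p b = Valid n r p × X r p ≡ b

    local : ∀ {X p b} → Shows X p b → Local X p b
    local {X} {p} {b} s with v , x ← s r p (here refl) = v , trans x (not-xor-true b)

    shows : ∀ {X p b} → Local X p b → Shows X p b
    shows {b = b} (v , x) _ _ (here refl) = v , trans x (sym (not-xor-true b))

    row-sweep : ∀ {X g ps} → Ballot g 0 ps → AllPairs _<_ ps → All (λ p → Local X p (g p)) ps →
                Moves n X (X ⊕ tiles ps)
    row-sweep b sorted ls = sweep-all b sorted (All.map shows ls)
      where
      pair : ∀ {X x y} → x < y → Shows X x true → Shows X y false →
             Moves n X (X ⊕ (cells (tile x) ⊻ cells (tile y)))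
      pair {x = x} {y} x<y sx sy with vx , ex ← local sx | vy , ey ← local sy =
        ⊕-cong (λ i j _ → cells-++ (tile x) (tile y) i j) (single-move (moveH vx vy x<y ex ey))
      single : ∀ {X x} → Shows X x true → Moves n X (X ⊕ cells (tile x))
      single sx with v , e ← local sx = single-move (moveP v e)
      open Sweep _<_ ℕ.<⇒≢ pair single

  module TwoRowSweep (n r r′ : ℕ) (r<r′ : r < r′) where

    tile : ℕ → List (ℕ × ℕ)
    tile p = (r , p) ∷ (r′ , p) ∷ []

    lower-row : Region
    lower-row i _ = i ≡ᵇ r′

    column-of : ∀ {c p} → c ∈ tile p → proj₂ c ≡ p
    column-of (here refl)         = refl
    column-of (there (here refl)) = refl

    tile-injective : ∀ {p q c} → c ∈ tile p → c ∈ tile q → p ≡ q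
    tile-injective m m′ = trans (sym (column-of m)) (column-of m′)

    tile-distinct : ∀ p → AllPairs _≢_ (tile p)
    tile-distinct _ = (rows-differ r<r′ ∷ []) ∷ [] ∷ []

    open Tiling n tile lower-row tile-distinct tile-injective public

    Local : Scheme → ℕ → Bool → Set
    Local X p b = Valid n r p × Valid n r′ p × X r p ≡ not b × X r′ p ≡ b

    local : ∀ {X p b} → Shows X p b → Local X p b
    local {X} {p} {b} s with v , x ← s r p (here refl) | v′ , x′ ← s r′ p (there (here refl))
      rewrite dec-false (r ≟ r′) (ℕ.<⇒≢ r<r′) | dec-true (r′ ≟ r′) refl =
      v , v′ , trans x (xor-identityʳ (not b)) , trans x′ (not-xor-true b)

    shows : ∀ {X p b} → Local X p b → Shows X p b
    shows {b = b} (v , _ , x , _) _ _ (here refl)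
      rewrite dec-false (r ≟ r′) (ℕ.<⇒≢ r<r′) = v , trans x (sym (xor-identityʳ (not b)))
    shows {b = b} (_ , v′ , _ , x′) _ _ (there (here refl))
      rewrite dec-true (r′ ≟ r′) refl = v′ , trans x′ (sym (not-xor-true b))

    two-row-sweep : ∀ {X g ps} → Ballot g 0 ps → AllPairs _<_ ps → All (λ p → Local X p (g p)) ps →
                    Moves n X (X ⊕ tiles ps)
    two-row-sweep b sorted ls = sweep-all b sorted (All.map shows ls)
      where
      pair : ∀ {X x y} → x < y → Shows X x true → Shows X y false →
             Moves n X (X ⊕ (cells (tile x) ⊻ cells (tile y)))
      pair {x = x} {y} x<y sx sy with v₁ , v₃ , e₁ , e₃ ← local sx | v₂ , v₄ , e₂ , e₄ ← local sy =
        ⊕-cong (λ i j _ → trans (cells-↭ middle-swap i j) (cells-++ (tile x) (tile y) i j))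
               (single-move (moveS v₁ v₂ v₃ v₄ r<r′ x<y e₁ e₂ e₃ e₄))
        where middle-swap = ↭.prep (r , x) (↭.swap (r , y) (r′ , x) (↭.refl {xs = (r′ , y) ∷ []}))
      single : ∀ {X x} → Shows X x true → Moves n X (X ⊕ cells (tile x))
      single sx with v , v′ , e , e′ ← local sx = single-move (moveV v v′ r<r′ e e′)
      open Sweep _<_ ℕ.<⇒≢ pair single

  module TwoColumnSweep (n c c′ : ℕ) (c<c′ : c < c′) where

    tile : ℕ → List (ℕ × ℕ)
    tile a = (suc a , c) ∷ (suc a , c′) ∷ []

    left-column : Region
    left-column _ j = j ≡ᵇ c

    row-of : ∀ {d a} → d ∈ tile a → proj₁ d ≡ suc a
    row-of (here refl)         = refl
    row-of (there (here refl)) = refl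

    tile-injective : ∀ {p q d} → d ∈ tile p → d ∈ tile q → p ≡ q
    tile-injective m m′ = ℕ.suc-injective (trans (sym (row-of m)) (row-of m′))

    tile-distinct : ∀ a → AllPairs _≢_ (tile a)
    tile-distinct _ = (columns-differ c<c′ ∷ []) ∷ [] ∷ []

    open Tiling n tile left-column tile-distinct tile-injective public

    Local : Scheme → ℕ → Bool → Set
    Local X a b = Valid n (suc a) c × Valid n (suc a) c′ × X (suc a) c ≡ b × X (suc a) c′ ≡ not b

    local : ∀ {X a b} → Shows X a b → Local X a b
    local {X} {a} {b} s with v , x ← s (suc a) c (here refl) | v′ , x′ ← s (suc a) c′ (there (here refl))
      rewrite dec-true (c ≟ c) refl | dec-false (c′ ≟ c) (ℕ.>⇒≢ c<c′) =
      v , v′ , trans x (not-xor-true b) , trans x′ (xor-identityʳ (not b))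

    shows : ∀ {X a b} → Local X a b → Shows X a b
    shows {b = b} (v , _ , x , _) _ _ (here refl)
      rewrite dec-true (c ≟ c) refl = v , trans x (sym (not-xor-true b))
    shows {b = b} (_ , v′ , _ , x′) _ _ (there (here refl))
      rewrite dec-false (c′ ≟ c) (ℕ.>⇒≢ c<c′) = v′ , trans x′ (sym (xor-identityʳ (not b)))

    two-column-sweep : ∀ {X g qs} → Ballot g 0 qs → AllPairs _>_ qs → All (λ a → Local X a (g a)) qs →
                       Moves n X (X ⊕ tiles qs)
    two-column-sweep b sorted ls = sweep-all b sorted (All.map shows ls)
      where
      pair : ∀ {X x y} → x > y → Shows X x true → Shows X y false →
             Moves n X (X ⊕ (cells (tile x) ⊻ cells (tile y)))
      pair {x = x} {y} x>y sx sy with v₃ , v₄ , e₃ , e₄ ← local sx | v₁ , v₂ , e₁ , e₂ ← local sy =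
        ⊕-cong (λ i j _ → trans (cells-↭ (++-comm (tile y) (tile x)) i j) (cells-++ (tile x) (tile y) i j))
               (single-move (moveS v₁ v₂ v₃ v₄ (s≤s x>y) c<c′ e₁ e₂ e₃ e₄))
      single : ∀ {X x} → Shows X x true → Moves n X (X ⊕ cells (tile x))
      single sx with v , v′ , e , e′ ← local sx = single-move (moveH v v′ c<c′ e e′)
      open Sweep _>_ ℕ.>⇒≢ pair single

  range : ℕ → ℕ → List ℕ
  range y zero    = []
  range y (suc d) = y ∷ range (suc y) d

  ∈-range⁺ : ∀ {y d p} → y ≤ p → p < y + d → p ∈ range y d
  ∈-range⁺ {y} {zero}  {p} y≤p p<y = ⊥-elim (ℕ.<⇒≱ (subst (p <_) (ℕ.+-identityʳ y) p<y) y≤p)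
  ∈-range⁺ {y} {suc d} {p} y≤p p<y+d with ℕ.m≤n⇒m<n∨m≡n y≤p
  ... | inj₂ refl = here refl
  ... | inj₁ y<p  = there (∈-range⁺ y<p (subst (p <_) (ℕ.+-suc y d) p<y+d))

  ∈-range⁻ : ∀ {y d p} → p ∈ range y d → y ≤ p × p < y + d
  ∈-range⁻ {y} {suc d} (here refl) = ℕ.≤-refl , ℕ.m<m+n y (s≤s z≤n)
  ∈-range⁻ {y} {suc d} {p} (there p∈) with sy≤p , p< ← ∈-range⁻ p∈ =
    ℕ.<⇒≤ sy≤p , subst (p <_) (sym (ℕ.+-suc y d)) p<

  range-sorted : ∀ y d → AllPairs _<_ (range y d)
  range-sorted y zero    = []
  range-sorted y (suc d) = All.tabulate (proj₁ ∘ ∈-range⁻) ∷ range-sorted (suc y) d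

  downFrom-sorted : ∀ v → AllPairs _>_ (downFrom v)
  downFrom-sorted v = applyDownFrom⁺₁ id v (λ j<i _ → j<i)

  ∈-filterᵇ⁺ : ∀ {Q : ℕ → Bool} {p ps} → p ∈ ps → Q p ≡ true → p ∈ filterᵇ Q ps
  ∈-filterᵇ⁺ {Q} p∈ q = ∈-filter⁺ (T? ∘ Q) p∈ (Equivalence.from T-≡ q)

  ∈-filterᵇ⁻ : ∀ {Q : ℕ → Bool} {p ps} → p ∈ filterᵇ Q ps → p ∈ ps × Q p ≡ true
  ∈-filterᵇ⁻ {Q} p∈ with p∈ps , q ← ∈-filter⁻ (T? ∘ Q) p∈ = p∈ps , Equivalence.to T-≡ q

  module AliveSets (n : ℕ) (cls : ℕ → Bool) where

    isA isB : (ℕ → Bool) → ℕ → Bool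
    isA alive y = alive y ∧ cls y
    isB alive y = alive y ∧ not (cls y)

    A-at : ∀ alive {y} → alive y ≡ true → cls y ≡ true → isA alive y ≡ true
    A-at _ ay cy = cong₂ _∧_ ay cy

    B-at : ∀ alive {y} → alive y ≡ true → cls y ≡ false → isB alive y ≡ true
    B-at _ ay cy = cong₂ (λ a c → a ∧ not c) ay cy

    A-not-B : ∀ {alive y} → isA alive y ≡ true → isB alive y ≡ true → ⊥
    A-not-B {alive} {y} a b
      with () ← trans (cong not (sym (∧-conicalʳ (alive y) (cls y) a))) (∧-conicalʳ (alive y) _ b)

    -- Cell (a + 1, b) belongs to the pair of indices a < b.
    AB : (ℕ → Bool) → Region
    AB alive zero    j = false
    AB alive (suc a) j = isA alive a ∧ isB alive j

    _∖_ : (ℕ → Bool) → (ℕ → Bool) → ℕ → Bool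
    (alive ∖ gone) y = not (gone y) ∧ alive y

    touched : (ℕ → Bool) → (ℕ → Bool) → Region
    touched alive gone zero    j = false
    touched alive gone (suc a) j = (gone a ∨ gone j) ∧ AB alive (suc a) j

    AB-split : ∀ alive gone i j → AB alive i j ≡ (touched alive gone ⊻ AB (alive ∖ gone)) i j
    AB-split alive gone zero    j = sym (⊻-at _ _ zero j)
    AB-split alive gone (suc a) j rewrite ⊻-at (touched alive gone) (AB (alive ∖ gone)) (suc a) j
      with gone a | gone j
    ... | true  | _     = sym (xor-identityʳ _)
    ... | false | true  = sym (trans (cong (AB alive (suc a) j xor_) (∧-zeroʳ (isA alive a))) (xor-identityʳ _))
    ... | false | false = refl

    untouched : ∀ alive gone i j → AB (alive ∖ gone) i j ≡ true → touched alive gone i j ≡ false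
    untouched alive gone (suc a) j ab with gone a | gone j
    ... | false | false = refl
    ... | false | true with () ← trans (sym (∧-zeroʳ (isA alive a))) ab

    Flipped : (ℕ → Bool) → Scheme → Set
    Flipped alive X = ∀ i j → Valid n i j → AB alive i j ≡ true → X i j ≡ not (C₋ i j)

    Bounded : (ℕ → Bool) → Set
    Bounded alive = ∀ y → alive y ≡ true → y ≤ n

    repair-by-removing : ∀ {alive} gone {X T} → (∀ i j → Valid n i j → T i j ≡ touched alive gone i j) →
                         Flipped alive X → Moves n X (X ⊕ T) →
                         (Flipped (alive ∖ gone) (X ⊕ T) → Moves n (X ⊕ T) (X ⊕ T ⊕ AB (alive ∖ gone))) →
                         Moves n X (X ⊕ AB alive)
    repair-by-removing {alive} gone {X} {T} T≡ flipped sweep rest = ⊕-cong regroup (sweep ▷ rest flipped′)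
      where
      regroup : ∀ i j → Valid n i j → (T ⊻ AB (alive ∖ gone)) i j ≡ AB alive i j
      regroup i j v = begin
        (T ⊻ AB (alive ∖ gone)) i j                       ≡⟨ ⊻-at _ _ i j ⟩
        T i j xor AB (alive ∖ gone) i j                   ≡⟨ cong (_xor _) (T≡ i j v) ⟩
        touched alive gone i j xor AB (alive ∖ gone) i j  ≡⟨ sym (⊻-at _ _ i j) ⟩
        (touched alive gone ⊻ AB (alive ∖ gone)) i j      ≡⟨ sym (AB-split alive gone i j) ⟩
        AB alive i j                                      ∎
        where open ≡-Reasoning
      flipped′ : Flipped (alive ∖ gone) (X ⊕ T)
      flipped′ i j v ab′ = begin
        (X ⊕ T) i j                    ≡⟨ ⊕-at X T i j ⟩
        T i j xor X i j                ≡⟨ cong (_xor X i j) (trans (T≡ i j v) off) ⟩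
        X i j                          ≡⟨ flipped i j v (trans (AB-split alive gone i j) (trans (⊻-at _ _ i j)
                                                        (cong₂ _xor_ off ab′))) ⟩
        not (C₋ i j)                   ∎
        where
        open ≡-Reasoning
        off = untouched alive gone i j ab′

    count : (ℕ → Bool) → ℕ → ℕ
    count alive zero    = 0
    count alive (suc m) = if alive m then suc (count alive m) else count alive m

    count-∖-≤ : ∀ alive gone m → count (alive ∖ gone) m ≤ count alive m
    count-∖-≤ alive gone zero = z≤n
    count-∖-≤ alive gone (suc m) with gone m | alive m
    ... | true  | true  = ℕ.≤-trans (count-∖-≤ alive gone m) (ℕ.n≤1+n _)
    ... | true  | false = count-∖-≤ alive gone m
    ... | false | true  = s≤s (count-∖-≤ alive gone m)
    ... | false | false = count-∖-≤ alive gone m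

    count-∖-< : ∀ {alive gone y} m → alive y ≡ true → gone y ≡ true → y < m →
                count (alive ∖ gone) m < count alive m
    count-∖-< {alive} {gone} {y} (suc m) ay gy (s≤s y≤m) with ℕ.m≤n⇒m<n∨m≡n y≤m
    ... | inj₂ refl rewrite ay | gy = s≤s (count-∖-≤ alive gone y)
    ... | inj₁ y<m with gone m | alive m
    ...   | true  | true  = ℕ.≤-trans (count-∖-< m ay gy y<m) (ℕ.n≤1+n _)
    ...   | true  | false = count-∖-< m ay gy y<m
    ...   | false | true  = s≤s (count-∖-< m ay gy y<m)
    ...   | false | false = count-∖-< m ay gy y<m

    Dead : (ℕ → Bool) → ℕ → ℕ → Set
    Dead alive a b = ∀ y → a < y → y < b → alive y ≡ false

    NoneBelow : (ℕ → Bool) → ℕ → Set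
    NoneBelow alive b = ∀ y → y < b → alive y ≡ false

    no-A-in : ∀ {alive a b} → Dead alive a b → ∀ y → a < y → y < b → isA alive y ≡ false
    no-A-in dead y a<y y<b rewrite dead y a<y y<b = refl

    below-suc : ∀ {alive : ℕ → Bool} {x y} → alive x ≡ false → (y < x → alive y ≡ false) → y < suc x →
                alive y ≡ false
    below-suc ax below y<sx with ℕ.m≤n⇒m<n∨m≡n (ℕ.≤-pred y<sx)
    ... | inj₁ y<x  = below y<x
    ... | inj₂ refl = ax

    previous : ∀ alive x → (∃[ p ] p < x × alive p ≡ true × Dead alive p x) ⊎ NoneBelow alive x
    previous alive zero    = inj₂ (λ _ ())
    previous alive (suc x) with alive x in ax | previous alive x
    ... | true  | _ = inj₁ (x , ℕ.≤-refl , ax , λ y x<y y≤x → ⊥-elim (ℕ.<⇒≱ x<y (ℕ.≤-pred y≤x)))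
    ... | false | inj₁ (p , p<x , ap , dead) =
      inj₁ (p , ℕ.≤-trans p<x (ℕ.n≤1+n x) , ap , λ y p<y → below-suc {alive} ax (dead y p<y))
    ... | false | inj₂ none = inj₂ (λ y → below-suc {alive} ax (none y))

    first : ∀ alive m → (∃[ f ] f < m × alive f ≡ true × NoneBelow alive f) ⊎ NoneBelow alive m
    first alive zero = inj₂ (λ _ ())
    first alive (suc m) with first alive m
    ... | inj₁ (f , f<m , af , none) = inj₁ (f , ℕ.≤-trans f<m (ℕ.n≤1+n m) , af , none)
    ... | inj₂ none with alive m in am
    ...   | true  = inj₁ (m , ℕ.≤-refl , am , none)
    ...   | false = inj₂ (λ y → below-suc {alive} am (none y))

    Alternating : (ℕ → Bool) → Set
    Alternating alive = ∀ {a b} → a < b → alive a ≡ true → alive b ≡ true → Dead alive a b →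
                        parity b ≡ not (parity a)

    only : ℕ → ℕ → Bool
    only x y = y ≡ᵇ x

    both : ℕ → ℕ → ℕ → Bool
    both u x y = only u y ∨ only x y

    only-true : ∀ {x y} → only x y ≡ true → y ≡ x
    only-true {x} {y} e with y ≡ᵇ x | proof (y ≟ x)
    ... | true  | ofʸ y≡x = y≡x
    ... | false | _ with () ← e

    both-true : ∀ {u x y} → both u x y ≡ true → y ≡ u ⊎ y ≡ x
    both-true {u} {x} {y} e with only u y in eu
    ... | true  = inj₁ (only-true {u} {y} eu)
    ... | false = inj₂ (only-true {x} {y} e)

    both-first : ∀ u x → both u x u ≡ true
    both-first u x rewrite dec-true (u ≟ u) refl = refl

    both-second : ∀ u x → both u x x ≡ true
    both-second u x rewrite dec-true (x ≟ x) refl = ∨-zeroʳ (x ≡ᵇ u)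

    survives : ∀ {alive gone y} → (alive ∖ gone) y ≡ true → alive y ≡ true × gone y ≡ false
    survives {alive} {gone} {y} e with gone y | alive y
    ... | false | true = refl , refl

    killed : ∀ {alive gone y} → alive y ≡ true → (alive ∖ gone) y ≡ false → gone y ≡ true
    killed {alive} {gone} {y} ay e with gone y
    ... | true = refl
    ... | false rewrite ay with () ← e

    bounded-∖ : ∀ {alive} gone → Bounded alive → Bounded (alive ∖ gone)
    bounded-∖ {alive} gone bnd y e = bnd y (proj₁ (survives {alive} {gone} e))

    alternating-∖-first : ∀ {alive f} → Alternating alive → NoneBelow alive f → Alternating (alive ∖ only f)
    alternating-∖-first {alive} {f} alt none {a} a<b a′ b′ dead′ = alt a<b aa ab dead
      where
      aa = proj₁ (survives {alive} {only f} a′)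
      ab = proj₁ (survives {alive} {only f} b′)
      dead : Dead alive a _
      dead y a<y y<b with alive y in ay
      ... | false = refl
      ... | true with refl ← only-true {f} {y} (killed {alive} {only f} ay (dead′ y a<y y<b))
                 with () ← trans (sym aa) (none a a<y)

    not-in-both : ∀ {u x y} → both u x y ≡ false → y ≢ u × y ≢ x
    not-in-both {u} {x} {y} e with y ≡ᵇ u | proof (y ≟ u) | y ≡ᵇ x | proof (y ≟ x)
    ... | false | ofⁿ y≢u | false | ofⁿ y≢x = y≢u , y≢x

    -- Unless a and b were consecutive before, the removed u and x lie between them.
    alternating-∖-two : ∀ {alive u x} → Alternating alive → u < x → alive u ≡ true → alive x ≡ true →
                        Dead alive u x →
                        Alternating (alive ∖ both u x)
    alternating-∖-two {alive} {u} {x} alt u<x au ax dead-ux {a} {b} a<b a′ b′ dead′ = via (previous alive b)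
      where
      aa = proj₁ (survives {alive} {both u x} a′)
      ab = proj₁ (survives {alive} {both u x} b′)
      a-spared = not-in-both {u} {x} {a} (proj₂ (survives {alive} {both u x} a′))
      b-spared = not-in-both {u} {x} {b} (proj₂ (survives {alive} {both u x} b′))

      removed : ∀ z → a < z → z < b → alive z ≡ true → z ≡ u ⊎ z ≡ x
      removed z a<z z<b az with only u z in eu | only x z in ex | killed {alive} {both u x} az (dead′ z a<z z<b)
      ... | true  | _    | _ = inj₁ (only-true {u} {z} eu)
      ... | false | true | _ = inj₂ (only-true {x} {z} ex)

      via : (∃[ p ] p < b × alive p ≡ true × Dead alive p b) ⊎ NoneBelow alive b → parity b ≡ not (parity a)
      via (inj₂ none) with () ← trans (sym aa) (none a a<b)
      via (inj₁ (p , p<b , ap , dead-pb)) with ℕ.<-cmp a p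
      ... | tri> _ _ p<a with () ← trans (sym aa) (dead-pb a p<a a<b)
      ... | tri≈ _ refl _ = alt a<b aa ab dead-pb
      ... | tri< a<p _ _ with removed p a<p p<b ap
      ...   | inj₁ refl with ℕ.<-cmp x b
      ...     | tri< x<b _ _ with () ← trans (sym ax) (dead-pb x u<x x<b)
      ...     | tri≈ _ refl _ = ⊥-elim (proj₂ b-spared refl)
      ...     | tri> _ _ b<x with () ← trans (sym ab) (dead-ux b p<b b<x)
      via (inj₁ (p , p<b , ap , dead-pb)) | tri< a<p _ _ | inj₂ refl with ℕ.<-cmp a u
      ...     | tri> _ _ u<a with () ← trans (sym aa) (dead-ux a u<a a<p)
      ...     | tri≈ _ refl _ = ⊥-elim (proj₁ a-spared refl)
      ...     | tri< a<u _ _ = begin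
        parity b             ≡⟨ alt p<b ax ab dead-pb ⟩
        not (parity x)       ≡⟨ cong not (alt u<x au ax dead-ux) ⟩
        not (not (parity u)) ≡⟨ not-involutive _ ⟩
        parity u             ≡⟨ alt a<u aa au dead-au ⟩
        not (parity a)       ∎
        where
        open ≡-Reasoning
        dead-au : Dead alive a u
        dead-au z a<z z<u with alive z in az
        ... | false = refl
        ... | true with removed z a<z (ℕ.<-trans z<u (ℕ.<-trans u<x p<b)) az
        ...   | inj₁ refl = ⊥-elim (ℕ.<-irrefl refl z<u)
        ...   | inj₂ refl = ⊥-elim (ℕ.<-irrefl refl (ℕ.<-trans z<u u<x))

module _ where

  import Data.Nat as ℕ
  open import Data.Integer using (ℤ; +_; -[1+_]; _+_; -_; _≤_; _<_)
  open import Data.Integer.Properties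
    using (≤-refl; ≤-trans; ≤-antisym; ≤-reflexive; <⇒≤; ≰⇒>; <-irrefl; ≤-<-trans; <-≤-trans; <-asym; _≤?_;
           +-identityʳ; +-comm; +-assoc; +-monoˡ-≤; neg-distrib-+; neg-cancel-≤;
           i≤pred[j]⇒i<j; suc[i]≤j⇒i<j; i<j⇒suc[i]≤j; +-0-abelianGroup; module ≤-Reasoning)
  open import Data.Integer.Tactic.RingSolver using (solve-∀)
  open import Algebra.Properties.AbelianGroup +-0-abelianGroup using (∙-cancelʳ; ∙-cancelˡ)

  sign : Bool → ℤ
  sign true  = + 1
  sign false = -[1+ 0 ]

  rise : Bool → ℕ → Bool
  rise δ y = parity y xor δ

  walk : (ℕ → ℤ) → ℕ → ℤ
  walk f zero    = + 0
  walk f (suc x) = walk f x + f x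

  opaque
    height : (ℕ → Bool) → Bool → ℕ → ℤ
    height Q δ = walk (λ y → if Q y then sign (rise δ y) else + 0)

    height-skip : ∀ {Q δ y} → Q y ≡ false → height Q δ (suc y) ≡ height Q δ y
    height-skip {Q} {δ} {y} e rewrite e = +-identityʳ _

    height-step : ∀ {Q δ y} → Q y ≡ true → height Q δ (suc y) ≡ height Q δ y + sign (rise δ y)
    height-step e rewrite e = refl

    height-flip : ∀ Q y → height Q true y ≡ - height Q false y
    height-flip Q zero    = refl
    height-flip Q (suc y) rewrite height-flip Q y with Q y
    ... | false = sym (neg-distrib-+ (height Q false y) (+ 0))
    ... | true with parity y
    ...   | true  = sym (neg-distrib-+ (height Q false y) (+ 1))
    ...   | false = sym (neg-distrib-+ (height Q false y) -[1+ 0 ])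

    height-split : ∀ (Q C : ℕ → Bool) δ y →
                   height Q δ y ≡ height (λ z → Q z ∧ C z) δ y + height (λ z → Q z ∧ not (C z)) δ y
    height-split Q C δ zero    = refl
    height-split Q C δ (suc y) rewrite height-split Q C δ y with Q y | C y
    ... | false | _     = neither (height (λ z → Q z ∧ C z) δ y) (height (λ z → Q z ∧ not (C z)) δ y)
      where neither : ∀ a b → a + b + + 0 ≡ (a + + 0) + (b + + 0)
            neither = solve-∀
    ... | true  | true  =
      onFirst (height (λ z → Q z ∧ C z) δ y) (height (λ z → Q z ∧ not (C z)) δ y) (sign (rise δ y))
      where onFirst : ∀ a b s → a + b + s ≡ (a + s) + (b + + 0)
            onFirst = solve-∀
    ... | true  | false =
      onSecond (height (λ z → Q z ∧ C z) δ y) (height (λ z → Q z ∧ not (C z)) δ y) (sign (rise δ y))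
      where onSecond : ∀ a b s → a + b + s ≡ (a + + 0) + (b + s)
            onSecond = solve-∀

  height-gap : ∀ {Q δ a b} → a ℕ.< b → (∀ y → a ℕ.< y → y ℕ.< b → Q y ≡ false) →
               height Q δ (suc a) ≡ height Q δ b
  height-gap {Q} {δ} {b = suc b} (s≤s a≤b) dead with ℕ.m≤n⇒m<n∨m≡n a≤b
  ... | inj₂ refl = refl
  ... | inj₁ a<b  = trans (height-gap a<b (λ y a<y y<b → dead y a<y (ℕ.m≤n⇒m≤1+n y<b)))
                          (sym (height-skip {Q} {δ} {b} (dead b a<b ℕ.≤-refl)))

  record LastMinimum (f : ℕ → ℤ) (N x : ℕ) : Set where
    field
      bounded : x ℕ.≤ N
      minimal : ∀ y → y ℕ.≤ N → f x ≤ f y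
      strict  : ∀ y → x ℕ.< y → y ℕ.≤ N → f x < f y

  last-minimum : ∀ f N → ∃[ x ] LastMinimum f N x
  last-minimum f zero = zero , record
    { bounded = z≤n ; minimal = λ { zero z≤n → ≤-refl } ; strict = λ { _ () z≤n } }
  last-minimum f (suc N) with last-minimum f N
  ... | x , m with f (suc N) ≤? f x
  ...   | yes fN≤fx = suc N , record
    { bounded = ℕ.≤-refl ; minimal = minimal ; strict = λ y N<y y≤N → ⊥-elim (ℕ.<⇒≱ N<y y≤N) }
    where
    minimal : ∀ y → y ℕ.≤ suc N → f (suc N) ≤ f y
    minimal y y≤ with ℕ.m≤n⇒m<n∨m≡n y≤
    ... | inj₁ y<    = ≤-trans fN≤fx (LastMinimum.minimal m y (ℕ.≤-pred y<))
    ... | inj₂ refl  = ≤-refl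
  ...   | no fN≰fx = x , record { bounded = ℕ.m≤n⇒m≤1+n (LastMinimum.bounded m) ; minimal = minimal ; strict = strict }
    where
    fx<fN = ≰⇒> fN≰fx
    minimal : ∀ y → y ℕ.≤ suc N → f x ≤ f y
    minimal y y≤ with ℕ.m≤n⇒m<n∨m≡n y≤
    ... | inj₁ y<    = LastMinimum.minimal m y (ℕ.≤-pred y<)
    ... | inj₂ refl  = <⇒≤ fx<fN
    strict : ∀ y → x ℕ.< y → y ℕ.≤ suc N → f x < f y
    strict y x<y y≤ with ℕ.m≤n⇒m<n∨m≡n y≤
    ... | inj₁ y<    = LastMinimum.strict m y x<y (ℕ.≤-pred y<)
    ... | inj₂ refl  = fx<fN

  lift : Bool → ℤ
  lift true  = + 1
  lift false = + 0

  descend : ∀ a → a + sign false < a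
  descend a = i≤pred[j]⇒i<j (≤-reflexive (+-comm a (sign false)))

  ascend : ∀ a → a < a + sign true
  ascend a = suc[i]≤j⇒i<j (≤-reflexive (+-comm (sign true) a))

  down-shift : ∀ {a b k} → a + sign false ≡ b + + k → a ≡ b + + suc k
  down-shift {a} {b} {k} e = trans (undo a) (trans (cong (_+ + 1) e) (regroup b (+ k)))
    where
    undo : ∀ a → a ≡ a + -[1+ 0 ] + + 1
    undo = solve-∀
    regroup : ∀ b k → b + k + + 1 ≡ b + (+ 1 + k)
    regroup = solve-∀

  up-shift : ∀ {a b k} → a + sign true ≡ b + + suc k → a ≡ b + + k
  up-shift {a} {b} {k} e = trans (undo a) (trans (cong (_+ -[1+ 0 ]) e) (regroup b (+ k)))
    where
    undo : ∀ a → a ≡ a + + 1 + -[1+ 0 ]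
    undo = solve-∀
    regroup : ∀ b k → b + (+ 1 + k) + -[1+ 0 ] ≡ b + k
    regroup = solve-∀

  lower-base : ∀ {b b′ k} → b′ ≡ b + sign false → b + + k ≡ b′ + + suc k
  lower-base {b} {k = k} refl = regroup b (+ k)
    where
    regroup : ∀ b k → b + k ≡ b + -[1+ 0 ] + (+ 1 + k)
    regroup = solve-∀

  raise-base : ∀ {b b′ k} → b′ ≡ b + sign true → b + + suc k ≡ b′ + + k
  raise-base {b} {k = k} refl = regroup b (+ k)
    where
    regroup : ∀ b k → b + (+ 1 + k) ≡ b + + 1 + k
    regroup = solve-∀

  sign-nonzero : ∀ {a} r → a + sign r ≢ a
  sign-nonzero {a} r e with ∙-cancelˡ a (sign r) (+ 0) (trans e (sym (+-identityʳ a)))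
  sign-nonzero true  e | ()
  sign-nonzero false e | ()

  sign+lift : ∀ r → sign r + lift (not r) ≡ lift r
  sign+lift true  = refl
  sign+lift false = refl

  rising-step : ∀ {Q δ x} → height Q δ x < height Q δ (suc x) → Q x ≡ true × rise δ x ≡ true
  rising-step {Q} {δ} {x} up with Q x in qx
  ... | false = ⊥-elim (<-irrefl (sym (height-skip qx)) up)
  ... | true with rise δ x in rx
  ...   | true  = refl , refl
  ...   | false = ⊥-elim (<-asym up (subst (_< height Q δ x) (sym falls) (descend (height Q δ x))))
    where falls = trans (height-step qx) (cong (λ r → height Q δ x + sign r) rx)

  module HeightsOf (n : ℕ) (cls : ℕ → Bool) where

    open AliveSets n cls

    rise-alternates : ∀ {δ a b} → parity b ≡ not (parity a) → rise δ b ≡ not (rise δ a)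
    rise-alternates {δ} {a} e rewrite e = sym (not-distribˡ-xor (parity a) δ)

    height-alternating : ∀ {alive} δ → Alternating alive → ∀ {a} b → Acc ℕ._<_ b → a ℕ.≤ b →
                         alive a ≡ true → alive b ≡ true →
                         height alive δ b + lift (rise δ b) ≡ height alive δ a + lift (rise δ a)
    height-alternating {alive} δ alt {a} b (acc rs) a≤b aa ab with ℕ.m≤n⇒m<n∨m≡n a≤b
    ... | inj₂ refl = refl
    ... | inj₁ a<b with previous alive b
    ...   | inj₂ none with () ← trans (sym aa) (none a a<b)
    ...   | inj₁ (p , p<b , ap , dead) = begin
      hE b + lift (rise δ b)                            ≡⟨ cong₂ _+_ (sym (height-gap {alive} p<b dead))
                                                                   (cong lift (rise-alternates {δ} {p} {b} (alt p<b ap ab dead))) ⟩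
      hE (suc p) + lift (not (rise δ p))                ≡⟨ cong (_+ lift (not (rise δ p))) (height-step {alive} ap) ⟩
      hE p + sign (rise δ p) + lift (not (rise δ p))    ≡⟨ +-assoc (hE p) _ _ ⟩
      hE p + (sign (rise δ p) + lift (not (rise δ p)))  ≡⟨ cong (λ s → hE p + s) (sign+lift (rise δ p)) ⟩
      hE p + lift (rise δ p)                            ≡⟨ height-alternating δ alt p (rs p<b) a≤p aa ap ⟩
      hE a + lift (rise δ a)                            ∎
      where
      open ≡-Reasoning
      hE = height alive δ
      a≤p : a ℕ.≤ p
      a≤p = ℕ.≮⇒≥ (λ p<a → case trans (sym aa) (dead a p<a a<b) of λ ())

    height-same-rise : ∀ {alive} δ → Alternating alive → ∀ {a b} → a ℕ.≤ b → alive a ≡ true → alive b ≡ true →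
                       rise δ a ≡ rise δ b → height alive δ b ≡ height alive δ a
    height-same-rise {alive} δ alt {a} {b} a≤b aa ab same =
      ∙-cancelʳ (lift (rise δ a)) _ _
        (trans (cong (λ r → height alive δ b + lift r) same) (height-alternating δ alt b (<-wellFounded b) a≤b aa ab))

    record Pivot (alive : ℕ → Bool) : Set where
      field
        δ      : Bool
        x      : ℕ
        x≤n    : x ℕ.≤ n
        lowest : LastMinimum (height (isA alive) δ) (suc n) x

    -- If the last minima for both signs were at n + 1 the height would be constant, yet it moves at f.
    choose-pivot : ∀ alive {f} → f ℕ.≤ n → isA alive f ≡ true → Pivot alive
    choose-pivot alive {f} f≤n af with last-minimum (height (isA alive) false) (suc n)
    ... | x , m with x ℕ.≤? n
    ...   | yes x≤n = record { δ = false ; x = x ; x≤n = x≤n ; lowest = m }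
    ...   | no x≰n with last-minimum (height (isA alive) true) (suc n)
    ...     | x′ , m′ with x′ ℕ.≤? n
    ...       | yes x′≤n = record { δ = true ; x = x′ ; x≤n = x′≤n ; lowest = m′ }
    ...       | no x′≰n = ⊥-elim (sign-nonzero (rise false f) flat)
      where
      h = height (isA alive) false
      top : ∀ {δ z} → LastMinimum (height (isA alive) δ) (suc n) z → ¬ z ℕ.≤ n → z ≡ suc n
      top m z≰n = ℕ.≤-antisym (LastMinimum.bounded m) (ℕ.≰⇒> z≰n)
      below-top : ∀ y → y ℕ.≤ suc n → h y ≤ h (suc n)
      below-top y y≤ = neg-cancel-≤ (subst₂ _≤_ (height-flip (isA alive) (suc n)) (height-flip (isA alive) y)
                         (subst (λ z → h′ z ≤ h′ y) (top m′ x′≰n) (LastMinimum.minimal m′ y y≤)))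
        where h′ = height (isA alive) true
      above-top : ∀ y → y ℕ.≤ suc n → h (suc n) ≤ h y
      above-top y y≤ = subst (λ z → h z ≤ h y) (top m x≰n) (LastMinimum.minimal m y y≤)
      f≤ = ℕ.m≤n⇒m≤1+n f≤n
      flat : h f + sign (rise false f) ≡ h f
      flat = trans (sym (height-step af)) (≤-antisym (≤-trans (below-top (suc f) (s≤s f≤n)) (above-top f f≤))
                                                     (≤-trans (below-top f f≤) (above-top (suc f) (s≤s f≤n))))

    module Descent (alive : ℕ → Bool) (δ : Bool) (v : ℕ)
                   (lowest : ∀ y → y ℕ.≤ v → height (isA alive) δ v ≤ height (isA alive) δ y) where

      h = height (isA alive) δ

      ballot-down : ∀ y → y ℕ.≤ v → ∀ k → h y ≡ h v + + k →
                    Ballot (not ∘ rise δ) k (filterᵇ (isA alive) (downFrom y))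
      ballot-down zero    _   k _ = []
      ballot-down (suc y) y<v k e with isA alive y in ay
      ... | false = ballot-down y (ℕ.<⇒≤ y<v) k (trans (sym (height-skip ay)) e)
      ... | true  = stepping (rise δ y) k refl (trans (sym (height-step ay)) e)
        where
        rest : ∀ k → h y ≡ h v + + k → Ballot (not ∘ rise δ) k (filterᵇ (isA alive) (downFrom y))
        rest = ballot-down y (ℕ.<⇒≤ y<v)
        stepping : ∀ r k → rise δ y ≡ r → h y + sign r ≡ h v + + k →
                   Ballot (not ∘ rise δ) k (y ∷ filterᵇ (isA alive) (downFrom y))
        stepping false k       ry e = push (cong not ry) (rest (suc k) (down-shift {b = h v} e))
        stepping true  (suc k) ry e = pop (cong not ry) (rest k (up-shift {b = h v} e))
        stepping true  zero    ry e =
          ⊥-elim (<-irrefl refl (≤-<-trans (lowest y (ℕ.<⇒≤ y<v))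
                                           (subst (h y <_) (trans e (+-identityʳ (h v))) (ascend (h y)))))

    module Ascent (alive : ℕ → Bool) (δ : Bool) (x : ℕ) (alt : Alternating alive)
                  (ax : isA alive x ≡ true) (rx : rise δ x ≡ true)
                  (above : ∀ y → x ℕ.< y → y ℕ.≤ suc n → height (isA alive) δ x < height (isA alive) δ y)
                  (bounded : Bounded alive) where

      hA = height (isA alive) δ
      hB = height (isB alive) δ
      hE = height alive δ

      alive-x : alive x ≡ true
      alive-x = ∧-conicalˡ (alive x) (cls x) ax

      rising-B-below-start : ∀ {y} → x ℕ.< y → isB alive y ≡ true → rise δ y ≡ true → hB (suc x) ≢ hB y
      rising-B-below-start {y} x<y by ry flat = <-irrefl refl (<-≤-trans (ascend (hE x)) (begin
        hE x + sign true           ≡⟨ sym (trans (height-step alive-x) (cong (λ r → hE x + sign r) rx)) ⟩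
        hE (suc x)                 ≡⟨ height-split alive cls δ (suc x) ⟩
        hA (suc x) + hB (suc x)    ≤⟨ +-monoˡ-≤ (hB (suc x)) climbed ⟩
        hA y + hB (suc x)          ≡⟨ cong (λ b → hA y + b) flat ⟩
        hA y + hB y                ≡⟨ sym (height-split alive cls δ y) ⟩
        hE y                       ≡⟨ height-same-rise δ alt (ℕ.<⇒≤ x<y) alive-x ay (trans rx (sym ry)) ⟩
        hE x                       ∎))
        where
        open ≤-Reasoning
        ay = ∧-conicalˡ (alive y) (not (cls y)) by
        climbed : hA (suc x) ≤ hA y
        climbed = subst (_≤ hA y) (trans (+-comm (+ 1) (hA x)) (sym (trans (height-step ax) (cong (λ r → hA x + sign r) rx))))
                        (i<j⇒suc[i]≤j (above y x<y (ℕ.m≤n⇒m≤1+n (bounded y ay))))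

      ballot-up : ∀ d y → x ℕ.< y → ∀ k → hB (suc x) ≡ hB y + + k →
                  Ballot (not ∘ rise δ) k (filterᵇ (isB alive) (range y d))
      ballot-up zero    y _   k _ = []
      ballot-up (suc d) y x<y k e with isB alive y in by
      ... | false = ballot-up d (suc y) (ℕ.m<n⇒m<1+n x<y) k (trans e (cong (_+ + k) (sym (height-skip by))))
      ... | true  = stepping (rise δ y) k refl e
        where
        rest : ∀ k → hB (suc x) ≡ hB (suc y) + + k → Ballot (not ∘ rise δ) k (filterᵇ (isB alive) (range (suc y) d))
        rest = ballot-up d (suc y) (ℕ.m<n⇒m<1+n x<y)
        next : ∀ {r} → rise δ y ≡ r → hB (suc y) ≡ hB y + sign r
        next ry = trans (height-step by) (cong (λ r → hB y + sign r) ry)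
        stepping : ∀ r k → rise δ y ≡ r → hB (suc x) ≡ hB y + + k →
                   Ballot (not ∘ rise δ) k (y ∷ filterᵇ (isB alive) (range (suc y) d))
        stepping false k       ry e = push (cong not ry) (rest (suc k) (trans e (lower-base {hB y} (next ry))))
        stepping true  (suc k) ry e = pop (cong not ry) (rest k (trans e (raise-base {hB y} (next ry))))
        stepping true  zero    ry e = ⊥-elim (rising-B-below-start x<y by ry (trans e (+-identityʳ (hB y))))

module _ where

  open import Data.Nat using (_≤_; _<_; _>_; _∸_; _+_; _≟_; _≡ᵇ_; _≤ᵇ_)
  open import Data.Integer as ℤ using (+_)
  open import Data.Integer.Properties using (+-identityʳ; <-irrefl; <-≤-trans)

  ∨-split : ∀ {b c} → b ∨ c ≡ true → b ≡ true ⊎ c ≡ true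
  ∨-split {true}  _ = inj₁ refl
  ∨-split {false} e = inj₂ e

  bool-ext : ∀ {b c} → (b ≡ true → c ≡ true) → (c ≡ true → b ≡ true) → b ≡ c
  bool-ext {false} {false} _ _ = refl
  bool-ext {false} {true}  _ f = f refl
  bool-ext {true}  {_}     t _ = sym (t refl)

  C₋-parity : ∀ {a b} → a < b → C₋ (suc a) b ≡ not (parity a xor parity b)
  C₋-parity {zero}  {suc b} _         = solve 1 (λ p → p := con true :+ (con true :+ p)) refl (parity (suc b))
  C₋-parity {suc a} {suc b} (s≤s a<b) = trans (C₋-parity a<b) (cong not (both-flipped (parity a) (parity b)))
    where
    both-flipped : ∀ p q → p xor q ≡ not p xor not q
    both-flipped = solve 2 (λ p q → p :+ q := (con true :+ p) :+ (con true :+ q)) refl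

  C₋-rise : ∀ δ {a b} → a < b → C₋ (suc a) b ≡ not (rise δ a xor rise δ b)
  C₋-rise δ {a} {b} a<b = trans (C₋-parity a<b) (cong not (shift (parity a) (parity b) δ))
    where
    shift : ∀ p q d → p xor q ≡ (p xor d) xor (q xor d)
    shift = solve 3 (λ p q d → p :+ q := (p :+ d) :+ (q :+ d)) refl

  module Reduction (n : ℕ) (cls : ℕ → Bool) where

    open AliveSets n cls
    open HeightsOf n cls

    Repairable : (ℕ → Bool) → Set
    Repairable alive = Alternating alive → Bounded alive → ∀ X → Flipped alive X → Moves n X (X ⊕ AB alive)

    RepairableBelow : (ℕ → Bool) → Set
    RepairableBelow alive = ∀ alive′ → count alive′ (suc n) < count alive (suc n) → Repairable alive′

    flipped-at : ∀ {alive X} δ → Flipped alive X → Bounded alive → ∀ {a b} → a < b →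
                 isA alive a ≡ true → isB alive b ≡ true → X (suc a) b ≡ rise δ a xor rise δ b
    flipped-at {alive} δ flipped bnd {a} {b} a<b aa bb =
      trans (flipped (suc a) b (s≤s z≤n , a<b , bnd b (∧-conicalˡ (alive b) _ bb)) (cong₂ _∧_ aa bb))
            (trans (cong not (C₋-rise δ a<b)) (not-involutive _))

    rise-period-two : ∀ {alive} δ → Alternating alive → ∀ {v u x} → v < u → u < x →
                      alive v ≡ true → alive u ≡ true → alive x ≡ true → Dead alive v u → Dead alive u x →
                      rise δ x ≡ rise δ v
    rise-period-two δ alt {v} {u} {x} v<u u<x av au ax dead-vu dead-ux =
      trans (rise-alternates {δ} {u} {x} (alt u<x au ax dead-ux))
            (trans (cong not (rise-alternates {δ} {v} {u} (alt v<u av au dead-vu))) (not-involutive _))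

    height-A-skips-B : ∀ {alive} δ {v u} → v < u → isB alive v ≡ true → Dead alive v u →
                       height (isA alive) δ v ≡ height (isA alive) δ u
    height-A-skips-B {alive} δ {v} {u} v<u bv dead =
      trans (sym (height-skip {isA alive} {δ} {v} v-not-A)) (height-gap {isA alive} v<u (no-A-in dead))
      where
      v-not-A : isA alive v ≡ false
      v-not-A with cls v | ∧-conicalʳ (alive v) (not (cls v)) bv
      ... | false | _ = ∧-zeroʳ (alive v)

    below-range-end : ∀ {x j} → x ≤ n → j ≤ n → j < suc x + (n ∸ x)
    below-range-end {x} x≤n j≤n = s≤s (subst (_ ≤_) (sym (ℕ.m+[n∸m]≡n x≤n)) j≤n)

    module LaterB (alive : ℕ → Bool) (x : ℕ) (x≤n : x ≤ n) where

      later : List ℕ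
      later = filterᵇ (isB alive) (range (suc x) (n ∸ x))

      later-sorted : AllPairs _<_ later
      later-sorted = filter⁺ (T? ∘ isB alive) (range-sorted (suc x) (n ∸ x))

      ∈-later⁻ : ∀ {p} → p ∈ later → x < p × isB alive p ≡ true
      ∈-later⁻ p∈ with p∈range , bp ← ∈-filterᵇ⁻ {isB alive} {ps = range (suc x) (n ∸ x)} p∈ =
        proj₁ (∈-range⁻ p∈range) , bp

      ∈-later⁺ : ∀ {p} → x < p → p ≤ n → isB alive p ≡ true → p ∈ later
      ∈-later⁺ x<p p≤n bp = ∈-filterᵇ⁺ {isB alive} (∈-range⁺ x<p (below-range-end x≤n p≤n)) bp

    module EarlierA (alive : ℕ → Bool) (v : ℕ) where

      earlier : List ℕ
      earlier = filterᵇ (isA alive) (downFrom v)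

      earlier-sorted : AllPairs _>_ earlier
      earlier-sorted = filter⁺ (T? ∘ isA alive) (downFrom-sorted v)

      ∈-earlier⁻ : ∀ {a} → a ∈ earlier → a < v × isA alive a ≡ true
      ∈-earlier⁻ a∈ with a∈v , aa ← ∈-filterᵇ⁻ {isA alive} {ps = downFrom v} a∈ = ∈-downFrom⁻ a∈v , aa

      ∈-earlier⁺ : ∀ {a} → a < v → isA alive a ≡ true → a ∈ earlier
      ∈-earlier⁺ a<v aa = ∈-filterᵇ⁺ {isA alive} (∈-downFrom⁺ a<v) aa

    repair-nothing-alive : ∀ {alive} → NoneBelow alive (suc n) → Repairable alive
    repair-nothing-alive {alive} none _ _ X _ =
      done (λ i j v → sym (trans (⊕-at X (AB alive) i j) (cong (_xor X i j) (empty i j v))))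
      where
      empty : ∀ i j → Valid n i j → AB alive i j ≡ false
      empty (suc a) j (_ , a<j , j≤n) rewrite none a (s≤s (ℕ.≤-trans (ℕ.<⇒≤ a<j) j≤n)) = refl

    repair-first-B : ∀ {alive f} → RepairableBelow alive → f ≤ n → alive f ≡ true → cls f ≡ false →
                     NoneBelow alive f → Repairable alive
    repair-first-B {alive} {f} ih f≤n af cf none alt bnd X flipped =
      repair-by-removing (only f) untouched-by-f flipped (done (λ i j _ → sym (⊕-∅ X i j)))
        (ih (alive ∖ only f) (count-∖-< (suc n) af (dec-true (f ≟ f) refl) (s≤s f≤n))
            (alternating-∖-first alt none) (bounded-∖ (only f) bnd) (X ⊕ ∅))
      where
      untouched-by-f : ∀ i j → Valid n i j → ∅ i j ≡ touched alive (only f) i j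
      untouched-by-f (suc a) j (_ , a<j , _) with a ≡ᵇ f | proof (a ≟ f) | j ≡ᵇ f | proof (j ≟ f)
      ... | true  | ofʸ refl | _     | _        rewrite af | cf = refl
      ... | false | _        | true  | ofʸ refl rewrite none a a<j = refl
      ... | false | _        | false | _        = refl

    module AtPivot {alive : ℕ → Bool} (ih : RepairableBelow alive) (alt : Alternating alive) (bnd : Bounded alive)
                   {X : Scheme} (flipped : Flipped alive X) (δ : Bool) {x : ℕ} (x≤n : x ≤ n)
                   (lowest : LastMinimum (height (isA alive) δ) (suc n) x)
                   (ax : isA alive x ≡ true) (rx : rise δ x ≡ true) where

      open Ascent alive δ x alt ax rx (LastMinimum.strict lowest) bnd using (ballot-up; alive-x)
      open LaterB alive x x≤n

      h : ℕ → ℤ.ℤ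
      h = height (isA alive) δ

      later-ballot : Ballot (not ∘ rise δ) 0 later
      later-ballot = ballot-up (n ∸ x) (suc x) ℕ.≤-refl 0 (sym (+-identityʳ _))

      repair-row : NoneBelow alive x → Moves n X (X ⊕ AB alive)
      repair-row none =
        repair-by-removing (only x) tiles≡touched flipped sweep
          (ih (alive ∖ only x) (count-∖-< (suc n) alive-x (dec-true (x ≟ x) refl) (s≤s x≤n))
              (alternating-∖-first alt none) (bounded-∖ (only x) bnd) (X ⊕ tiles later))
        where
        open RowSweep n (suc x)
        labelled : ∀ {p} → p ∈ later → Local X p (not (rise δ p))
        labelled {p} p∈ with x<p , bp ← ∈-later⁻ p∈ =
          (s≤s z≤n , x<p , bnd p (∧-conicalˡ (alive p) _ bp)) ,
          trans (flipped-at δ flipped bnd x<p ax bp) (cong (_xor rise δ p) rx)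
        sweep : Moves n X (X ⊕ tiles later)
        sweep = row-sweep later-ballot later-sorted (All.tabulate labelled)
        tiles≡touched : ∀ i j → Valid n i j → tiles later i j ≡ touched alive (only x) i j
        tiles≡touched (suc a) j (_ , a<j , j≤n) = bool-ext inside outside
          where
          inside : tiles later (suc a) j ≡ true → touched alive (only x) (suc a) j ≡ true
          inside t with p , p∈ , here refl ← tiles-true later t rewrite dec-true (x ≟ x) refl | ax = proj₂ (∈-later⁻ p∈)
          outside : touched alive (only x) (suc a) j ≡ true → tiles later (suc a) j ≡ true
          outside t with a ≡ᵇ x | proof (a ≟ x) | j ≡ᵇ x | proof (j ≟ x)
          ... | true  | ofʸ refl | _     | _        =
            tiles-hit (AllPairs.map ℕ.<⇒≢ later-sorted) (∈-later⁺ a<j j≤n (∧-conicalʳ (isA alive x) _ t)) (here refl)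
          ... | false | _        | true  | ofʸ refl = ⊥-elim (A-not-B {alive} ax (∧-conicalʳ (isA alive a) _ t))
          ... | false | _        | false | _        with () ← t

      repair-two-rows : ∀ {u} → u < x → isA alive u ≡ true → Dead alive u x → Moves n X (X ⊕ AB alive)
      repair-two-rows {u} u<x au dead =
        repair-by-removing (both u x) tiles≡touched flipped sweep
          (ih (alive ∖ both u x) (count-∖-< (suc n) alive-u (both-first u x) (s≤s (ℕ.≤-trans (ℕ.<⇒≤ u<x) x≤n)))
              (alternating-∖-two alt u<x alive-u alive-x dead) (bounded-∖ (both u x) bnd) (X ⊕ tiles later))
        where
        open TwoRowSweep n (suc u) (suc x) (s≤s u<x)
        alive-u = ∧-conicalˡ (alive u) (cls u) au
        ru : rise δ u ≡ false
        ru = trans (sym (not-involutive _))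
                   (cong not (trans (sym (rise-alternates {δ} {u} {x} (alt u<x alive-u alive-x dead))) rx))
        labelled : ∀ {p} → p ∈ later → Local X p (not (rise δ p))
        labelled {p} p∈ with x<p , bp ← ∈-later⁻ p∈ =
          (s≤s z≤n , ℕ.<-trans u<x x<p , p≤n) , (s≤s z≤n , x<p , p≤n) ,
          trans (flipped-at δ flipped bnd (ℕ.<-trans u<x x<p) au bp) (trans (cong (_xor rise δ p) ru) (sym (not-involutive _))) ,
          trans (flipped-at δ flipped bnd x<p ax bp) (cong (_xor rise δ p) rx)
          where p≤n = bnd p (∧-conicalˡ (alive p) _ bp)
        sweep : Moves n X (X ⊕ tiles later)
        sweep = two-row-sweep later-ballot later-sorted (All.tabulate labelled)
        tiles≡touched : ∀ i j → Valid n i j → tiles later i j ≡ touched alive (both u x) i j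
        tiles≡touched (suc a) j (_ , a<j , j≤n) = bool-ext inside outside
          where
          inside : tiles later (suc a) j ≡ true → touched alive (both u x) (suc a) j ≡ true
          inside t with tiles-true later t
          ... | p , p∈ , here refl         rewrite both-first u x  | au = proj₂ (∈-later⁻ p∈)
          ... | p , p∈ , there (here refl) rewrite both-second u x | ax = proj₂ (∈-later⁻ p∈)
          outside : touched alive (both u x) (suc a) j ≡ true → tiles later (suc a) j ≡ true
          outside t with ∨-split (∧-conicalˡ (both u x a ∨ both u x j) _ t)
                       | ∧-conicalʳ (isA alive a) (isB alive j) (∧-conicalʳ (both u x a ∨ both u x j) _ t)
          ... | inj₂ gj | bj with both-true {u} {x} {j} gj
          ...   | inj₁ refl = ⊥-elim (A-not-B {alive} au bj)
          ...   | inj₂ refl = ⊥-elim (A-not-B {alive} ax bj)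
          outside t | inj₁ ga | bj with both-true {u} {x} {a} ga
          ...   | inj₂ refl = tiles-hit (AllPairs.map ℕ.<⇒≢ later-sorted) (∈-later⁺ a<j j≤n bj) (there (here refl))
          ...   | inj₁ refl with ℕ.<-cmp x j
          ...     | tri< x<j _ _  = tiles-hit (AllPairs.map ℕ.<⇒≢ later-sorted) (∈-later⁺ x<j j≤n bj) (here refl)
          ...     | tri≈ _ refl _ = ⊥-elim (A-not-B {alive} ax bj)
          ...     | tri> _ _ j<x  with () ← trans (sym (∧-conicalˡ (alive j) _ bj)) (dead j a<j j<x)

      no-A-then-B : ∀ {v u} → v < u → u < x → isA alive v ≡ true → isB alive u ≡ true →
                    Dead alive v u → Dead alive u x → ⊥
      no-A-then-B {v} {u} v<u u<x av bu dead-vu dead-ux =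
        <-irrefl refl (<-≤-trans (ascend (h v)) (subst (ℤ._≤ h v) climb x-lowest))
        where
        alive-v = ∧-conicalˡ (alive v) _ av
        x-lowest = LastMinimum.minimal lowest v (ℕ.≤-trans (ℕ.<⇒≤ (ℕ.<-trans v<u u<x)) (ℕ.m≤n⇒m≤1+n x≤n))
        rv : rise δ v ≡ true
        rv = trans (sym (rise-period-two δ alt v<u u<x alive-v (∧-conicalˡ (alive u) _ bu) alive-x dead-vu dead-ux)) rx
        climb : h x ≡ h v ℤ.+ sign true
        climb = begin
          h x                     ≡⟨ sym (height-A-skips-B δ u<x bu dead-ux) ⟩
          h u                     ≡⟨ sym (height-gap {isA alive} v<u (no-A-in dead-vu)) ⟩
          h (suc v)               ≡⟨ height-step av ⟩
          h v ℤ.+ sign (rise δ v) ≡⟨ cong (λ r → h v ℤ.+ sign r) rv ⟩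
          h v ℤ.+ sign true       ∎
          where open ≡-Reasoning

      repair-two-columns : ∀ {v u} → v < u → u < x → isB alive v ≡ true → isB alive u ≡ true →
                           Dead alive v u → Dead alive u x → Moves n X (X ⊕ AB alive)
      repair-two-columns {v} {u} v<u u<x bv bu dead-vu dead-ux =
        repair-by-removing (both v u) tiles≡touched flipped sweep
          (ih (alive ∖ both v u) (count-∖-< (suc n) alive-v (both-first v u) (s≤s v≤n))
              (alternating-∖-two alt v<u alive-v alive-u dead-vu) (bounded-∖ (both v u) bnd) (X ⊕ tiles earlier))
        where
        open TwoColumnSweep n v u v<u
        open EarlierA alive v
        alive-v = ∧-conicalˡ (alive v) _ bv
        alive-u = ∧-conicalˡ (alive u) _ bu
        v≤n = ℕ.≤-trans (ℕ.<⇒≤ (ℕ.<-trans v<u u<x)) x≤n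
        u≤n = ℕ.≤-trans (ℕ.<⇒≤ u<x) x≤n
        rv : rise δ v ≡ true
        rv = trans (sym (rise-period-two δ alt v<u u<x alive-v alive-u alive-x dead-vu dead-ux)) rx
        ru : rise δ u ≡ false
        ru = trans (rise-alternates {δ} {v} {u} (alt v<u alive-v alive-u dead-vu)) (cong not rv)
        v-lowest : ∀ y → y ≤ v → h v ℤ.≤ h y
        v-lowest y y≤v = subst (ℤ._≤ h y) (sym (trans (height-A-skips-B δ v<u bv dead-vu) (height-A-skips-B δ u<x bu dead-ux)))
                               (LastMinimum.minimal lowest y (ℕ.m≤n⇒m≤1+n (ℕ.≤-trans y≤v v≤n)))
        open Descent alive δ v v-lowest using (ballot-down)
        labelled : ∀ {a} → a ∈ earlier → Local X a (not (rise δ a))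
        labelled {a} a∈ with a<v , aa ← ∈-earlier⁻ a∈ =
          (s≤s z≤n , a<v , v≤n) , (s≤s z≤n , ℕ.<-trans a<v v<u , u≤n) ,
          trans (flipped-at δ flipped bnd a<v aa bv) (trans (cong (rise δ a xor_) rv) (xor-true _)) ,
          trans (flipped-at δ flipped bnd (ℕ.<-trans a<v v<u) aa bu)
                (trans (cong (rise δ a xor_) ru) (trans (xor-identityʳ _) (sym (not-involutive _))))
        sweep : Moves n X (X ⊕ tiles earlier)
        sweep = two-column-sweep (ballot-down v ℕ.≤-refl 0 (sym (+-identityʳ _))) earlier-sorted (All.tabulate labelled)
        tiles≡touched : ∀ i j → Valid n i j → tiles earlier i j ≡ touched alive (both v u) i j
        tiles≡touched (suc a) j (_ , a<j , j≤n) = bool-ext inside outside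
          where
          inside : tiles earlier (suc a) j ≡ true → touched alive (both v u) (suc a) j ≡ true
          inside t with tiles-true earlier t
          ... | p , p∈ , here refl rewrite both-first v u | ∨-zeroʳ (both v u p) | proj₂ (∈-earlier⁻ p∈) = bv
          ... | p , p∈ , there (here refl) rewrite both-second v u | ∨-zeroʳ (both v u p) | proj₂ (∈-earlier⁻ p∈) = bu
          outside : touched alive (both v u) (suc a) j ≡ true → tiles earlier (suc a) j ≡ true
          outside t with ∨-split (∧-conicalˡ (both v u a ∨ both v u j) _ t) | ∧-conicalʳ (both v u a ∨ both v u j) _ t
          ... | inj₁ ga | ab with both-true {v} {u} {a} ga
          ...   | inj₁ refl = ⊥-elim (A-not-B {alive} (∧-conicalˡ _ _ ab) bv)
          ...   | inj₂ refl = ⊥-elim (A-not-B {alive} (∧-conicalˡ _ _ ab) bu)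
          outside t | inj₂ gj | ab with both-true {v} {u} {j} gj
          ...   | inj₁ refl =
            tiles-hit (AllPairs.map ℕ.>⇒≢ earlier-sorted) (∈-earlier⁺ a<j (∧-conicalˡ _ _ ab)) (here refl)
          ...   | inj₂ refl with ℕ.<-cmp a v
          ...     | tri< a<v _ _  =
            tiles-hit (AllPairs.map ℕ.>⇒≢ earlier-sorted) (∈-earlier⁺ a<v (∧-conicalˡ _ _ ab)) (there (here refl))
          ...     | tri≈ _ refl _ = ⊥-elim (A-not-B {alive} (∧-conicalˡ _ _ ab) bv)
          ...     | tri> _ _ v<a  with () ← trans (sym (∧-conicalˡ (alive a) _ (∧-conicalˡ _ _ ab))) (dead-vu a v<a a<j)

      repair : ∀ {f} → alive f ≡ true → cls f ≡ true → NoneBelow alive f → Moves n X (X ⊕ AB alive)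
      repair {f} af cf none-f with previous alive x
      ... | inj₂ none = repair-row none
      ... | inj₁ (u , u<x , alive-u , dead-ux) with cls u in cu
      ...   | true  = repair-two-rows u<x (A-at alive alive-u cu) dead-ux
      ...   | false with previous alive u
      ...     | inj₂ none-u with ℕ.<-cmp f u
      ...       | tri< f<u _ _  with () ← trans (sym af) (none-u f f<u)
      ...       | tri≈ _ refl _ with () ← trans (sym cf) cu
      ...       | tri> _ _ u<f  with () ← trans (sym alive-u) (none-f u u<f)
      repair {f} af cf none-f | inj₁ (u , u<x , alive-u , dead-ux) | false | inj₁ (v , v<u , alive-v , dead-vu)
        with cls v in cv
      ... | true  = ⊥-elim (no-A-then-B v<u u<x (A-at alive alive-v cv) (B-at alive alive-u cu) dead-vu dead-ux)
      ... | false = repair-two-columns v<u u<x (B-at alive alive-v cv) (B-at alive alive-u cu) dead-vu dead-ux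

    repair-at-pivot : ∀ {alive f} → RepairableBelow alive → alive f ≡ true → cls f ≡ true → NoneBelow alive f →
                      Pivot alive → Repairable alive
    repair-at-pivot ih af cf none-f record { δ = δ ; x = x ; x≤n = x≤n ; lowest = m } alt bnd X flipped
      with ax , rx ← rising-step (LastMinimum.strict m (suc x) ℕ.≤-refl (s≤s x≤n)) =
      AtPivot.repair ih alt bnd flipped δ x≤n m ax rx af cf none-f

    repairable : ∀ alive → Acc _<_ (count alive (suc n)) → Repairable alive
    repairable alive (acc rs) with first alive (suc n)
    ... | inj₂ none = repair-nothing-alive none
    ... | inj₁ (f , f≤n , af , none) with cls f in cf
    ...   | false = repair-first-B (λ alive′ lt → repairable alive′ (rs lt)) (ℕ.≤-pred f≤n) af cf none
    ...   | true  = repair-at-pivot (λ alive′ lt → repairable alive′ (rs lt)) af cf none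
                                    (choose-pivot alive (ℕ.≤-pred f≤n) (A-at alive af cf))

  prodFrom-split : ∀ ε i m k → prodFrom ε i (m + k) ≡ prodFrom ε i m · prodFrom ε (i + m) k
  prodFrom-split ε i zero    k rewrite ℕ.+-identityʳ i =
    solve 1 (λ p → p := con true :+ (con true :+ p)) refl (prodFrom ε i k)
  prodFrom-split ε i (suc m) k rewrite prodFrom-split ε (suc i) m k | ℕ.+-suc i m =
    solve 3 (λ e p q → con true :+ (e :+ (con true :+ (p :+ q))) := con true :+ ((con true :+ (e :+ p)) :+ q)) refl
          (ε i) (prodFrom ε (suc i) m) (prodFrom ε (suc (i + m)) k)

  prefix : (ℕ → Sign) → ℕ → Sign
  prefix ε = prodFrom ε 1

  schemeOf-prefix : ∀ ε {a b} → a < b → schemeOf ε (suc a) b ≡ prefix ε a · prefix ε b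
  schemeOf-prefix ε {a} {b} a<b = begin
    block                                  ≡⟨ cancel (prefix ε a) block ⟩
    prefix ε a · (prefix ε a · block)      ≡⟨ cong (prefix ε a ·_) (sym (prodFrom-split ε 1 a (suc d))) ⟩
    prefix ε a · prodFrom ε 1 (a + suc d)  ≡⟨ cong (λ m → prefix ε a · prodFrom ε 1 m) a+suc-d≡b ⟩
    prefix ε a · prefix ε b                ∎
    where
    open ≡-Reasoning
    d = b ∸ suc a
    block = schemeOf ε (suc a) b
    a+suc-d≡b = trans (ℕ.+-suc a d) (ℕ.m+[n∸m]≡n a<b)
    cancel : ∀ p s → s ≡ p · (p · s)
    cancel = solve 2 (λ p s → s := con true :+ (p :+ (con true :+ (p :+ s)))) refl

  class : (ℕ → Sign) → ℕ → Bool
  class ε a = prefix ε a xor parity a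

  schemeOf-class : ∀ ε {a b} → a < b → schemeOf ε (suc a) b ≡ (class ε a xor class ε b) xor C₋ (suc a) b
  schemeOf-class ε {a} {b} a<b = begin
    schemeOf ε (suc a) b                      ≡⟨ schemeOf-prefix ε a<b ⟩
    prefix ε a · prefix ε b                   ≡⟨ regroup (prefix ε a) (prefix ε b) (parity a) (parity b) ⟩
    c xor not (parity a xor parity b)         ≡⟨ cong (c xor_) (sym (C₋-parity a<b)) ⟩
    c xor C₋ (suc a) b                        ∎
    where
    open ≡-Reasoning
    c = class ε a xor class ε b
    regroup : ∀ p q r s → p · q ≡ ((p xor r) xor (q xor s)) xor not (r xor s)
    regroup = solve 4 (λ p q r s → con true :+ (p :+ q) := ((p :+ r) :+ (q :+ s)) :+ (con true :+ (r :+ s))) refl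

  indices : ℕ → ℕ → Bool
  indices n y = y ≤ᵇ n

  indices-≤ : ∀ {n y} → y ≤ n → indices n y ≡ true
  indices-≤ {n} {y} y≤n = Equivalence.to T-≡ (ℕ.≤⇒≤ᵇ y≤n)

  module Phases (n : ℕ) (ε : ℕ → Sign) where

    open AliveSets n using (AB; Flipped; Alternating; Bounded)

    X₀ : Scheme
    X₀ = schemeOf ε

    AB₁ AB₂ : Region
    AB₁ = AB (class ε) (indices n)
    AB₂ = AB (not ∘ class ε) (indices n)

    indices-bounded : ∀ c → Bounded c (indices n)
    indices-bounded c y e = ℕ.≤ᵇ⇒≤ y n (Equivalence.from T-≡ e)

    indices-alternating : ∀ c → Alternating c (indices n)
    indices-alternating c {a} {b} a<b _ bb dead with ℕ.m≤n⇒m<n∨m≡n a<b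
    ... | inj₂ refl = refl
    ... | inj₁ a+1<b with () ← trans (sym (indices-≤ (ℕ.≤-trans (ℕ.<⇒≤ a+1<b) (indices-bounded c b bb))))
                                      (dead (suc a) ℕ.≤-refl a+1<b)

    repair : ∀ c X → Flipped c (indices n) X → Moves n X (X ⊕ AB c (indices n))
    repair c = Reduction.repairable n c (indices n) (<-wellFounded _) (indices-alternating c) (indices-bounded c)

    AB-at : ∀ {a j} → a < j → j ≤ n → ∀ c → AB c (indices n) (suc a) j ≡ c a ∧ not (c j)
    AB-at a<j j≤n c rewrite indices-≤ (ℕ.≤-trans (ℕ.<⇒≤ a<j) j≤n) | indices-≤ j≤n = refl

    flipped₁ : Flipped (class ε) (indices n) X₀
    flipped₁ (suc a) j (_ , a<j , j≤n) ab
      with class ε a in ca | class ε j in cj | trans (sym (AB-at a<j j≤n (class ε))) ab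
    ... | true  | false | _ = trans (schemeOf-class ε a<j) (cong₂ (λ p q → (p xor q) xor C₋ (suc a) j) ca cj)
    ... | true  | true  | ()
    ... | false | _     | ()

    flipped₂ : Flipped (not ∘ class ε) (indices n) (X₀ ⊕ AB₁)
    flipped₂ (suc a) j (_ , a<j , j≤n) ab
      with class ε a in ca | class ε j in cj | trans (sym (AB-at a<j j≤n (not ∘ class ε))) ab
    ... | false | true  | _ = begin
      (X₀ ⊕ AB₁) (suc a) j                        ≡⟨ ⊕-at X₀ AB₁ (suc a) j ⟩
      AB₁ (suc a) j xor X₀ (suc a) j              ≡⟨ cong (_xor X₀ (suc a) j) (trans (AB-at a<j j≤n (class ε)) (cong (_∧ _) ca)) ⟩
      X₀ (suc a) j                                ≡⟨ schemeOf-class ε a<j ⟩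
      (class ε a xor class ε j) xor C₋ (suc a) j  ≡⟨ cong₂ (λ p q → (p xor q) xor C₋ (suc a) j) ca cj ⟩
      not (C₋ (suc a) j)                          ∎
      where open ≡-Reasoning
    ... | true  | _     | ()
    ... | false | false | ()

    cancels : SameScheme n (X₀ ⊕ (AB₁ ⊻ AB₂)) C₋
    cancels (suc a) j (_ , a<j , j≤n) = begin
      (X₀ ⊕ (AB₁ ⊻ AB₂)) (suc a) j                                   ≡⟨ ⊕-at X₀ _ (suc a) j ⟩
      (AB₁ ⊻ AB₂) (suc a) j xor X₀ (suc a) j                         ≡⟨ cong₂ _xor_ regions (schemeOf-class ε a<j) ⟩
      ((p ∧ not q) xor (not p ∧ not (not q))) xor ((p xor q) xor c)  ≡⟨ once-each p q c ⟩
      c                                                              ∎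
      where
      open ≡-Reasoning
      p = class ε a
      q = class ε j
      c = C₋ (suc a) j
      regions = trans (⊻-at AB₁ AB₂ (suc a) j) (cong₂ _xor_ (AB-at a<j j≤n (class ε)) (AB-at a<j j≤n (not ∘ class ε)))
      once-each : ∀ p q c → ((p ∧ not q) xor (not p ∧ not (not q))) xor ((p xor q) xor c) ≡ c
      once-each = solve 3 (λ p q c → ((p :* (con true :+ q)) :+ ((con true :+ p) :* (con true :+ (con true :+ q))))
                                     :+ ((p :+ q) :+ c) := c) refl

open import Data.Nat using (_≤_)

theorem2 : (n : ℕ) → 1 ≤ n → (ε : ℕ → Sign) →
    Moves n (schemeOf ε) C₋
theorem2 n _ ε =
  Moves-respʳ (repair (class ε) X₀ flipped₁ ▷ repair (not ∘ class ε) (X₀ ⊕ AB₁) flipped₂) cancels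
  where open Phases n ε
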